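{- Let $b,c$ be positive integers and $\mathcal{A}(P_b,P_c)$ the rank 2 generalised cluster algebra. For any generalised cluster $\mathbf{x}=(x_k,x_{k+1})$, the ring homomorphism $\psi_{\mathbf{x}}:\mathbb{Z}[x_k^{\pm1},x_{k+1}^{\pm1}]\to\mathbb{Z}$ with $\psi_{\mathbf{x}}(x_k)=\psi_{\mathbf{x}}(x_{k+1})=1$ restricts to a frieze of $\mathcal{A}(P_b,P_c)$. Moreover, generalised clusters that are distinct as unordered sets give rise to distinct friezes of $\mathcal{A}(P_b,P_c)$.
   Context: Let $x_1,x_2$ be commuting indeterminates and define $x_k\in\mathbb{Q}(x_1,x_2)$ for all $k\in\mathbb{Z}$ by $x_kx_{k+2}=(1+x_{k+1})^c$ for $k$ odd and $x_kx_{k+2}=(1+x_{k+1})^b$ for $k$ even. $\mathcal{A}(P_b,P_c)$ is the subring of $\mathbb{Q}(x_1,x_2)$ generated by all $x_k$ (the generalised cluster variables); each pair $(x_k,x_{k+1})$ is a generalised cluster. It is known that $\mathcal{A}(P_b,P_c)=\bigcap_k\mathbb{Z}[x_k^{\pm1},x_{k+1}^{\pm1}]$, so $\psi_{\mathbf{x}}$ is defined on it. A frieze of $\mathcal{A}(P_b,P_c)$ is a ring homomorphism $\mathcal{A}(P_b,P_c)\to\mathbb{Z}$ taking positive integer values on all generalised cluster variables. -}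

module Defs where

open import Data.Nat as ℕ using (ℕ; zero; suc)
open import Data.Integer as ℤ using (ℤ; +_; -[1+_]; ∣_∣)
open import Data.Rational as ℚ using (ℚ)
open import Data.Product using (_×_; _,_; proj₁; proj₂)
open import Data.Sum using (_⊎_)
open import Relation.Binary.PropositionalEquality using (_≡_)

-- Positive rationals, represented by predecessors:
-- (a , d) stands for (suc a) / (suc d).

PQ : Set
PQ = ℕ × ℕ

mul⁺ : ℕ → ℕ → ℕ
mul⁺ a b = ℕ.pred (suc a ℕ.* suc b)

-- predecessor of (suc a ^ e)
pow⁺ : ℕ → ℕ → ℕ
pow⁺ a zero    = 0
pow⁺ a (suc e) = mul⁺ a (pow⁺ a e)

onePQ : PQ
onePQ = 0 , 0

toℚ : PQ → ℚ
toℚ (a , d) = (+ suc a) ℚ./ suc d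

-- (1 + y) ^ e / x   for positive rationals x y
-- with x = (1+a)/(1+b), y = (1+p)/(1+q):
--   (1+y)^e / x = (2+p+q)^e (1+b) / ((1+q)^e (1+a))
exch : ℕ → PQ → PQ → PQ
exch e (a , b) (p , q) =
  mul⁺ (pow⁺ (suc (p ℕ.+ q)) e) b , mul⁺ (pow⁺ q e) a

-- The exchange exponent: x_j x_{j+2} = (1 + x_{j+1})^(expo j),
-- expo j = c for j odd, b for j even.

isOdd : ℤ → ℕ
isOdd j = ∣ j ∣ ℕ.% 2

expo : (b c : ℕ) → ℤ → ℕ
expo b c j with isOdd j
... | zero = b
... | suc _ = c

-- Values of the generalised cluster variables obtained from the
-- cluster (x_k, x_{k+1}) specialised to positive rationals (p , q).
-- forward: state (x_i , x_{i+1}) at index i  ↦ (x_{i+1}, x_{i+2})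
fwd : (b c : ℕ) → ℕ → ℤ → PQ × PQ → PQ
fwd b c zero    i (x , y) = x
fwd b c (suc n) i (x , y) = fwd b c n (i ℤ.+ ℤ.1ℤ) (y , exch (expo b c i) x y)

-- backward: state (x_i , x_{i+1}) at index i ↦ (x_{i-1}, x_i),
-- x_{i-1} = (1 + x_i)^(expo (i-1)) / x_{i+1}
bwd : (b c : ℕ) → ℕ → ℤ → PQ × PQ → PQ
bwd b c zero    i (x , y) = x
bwd b c (suc n) i (x , y) =
  bwd b c n (i ℤ.- ℤ.1ℤ) (exch (expo b c (i ℤ.- ℤ.1ℤ)) y x , x)

-- clusterVal b c k (p , q) j = value of x_j when x_k = p, x_{k+1} = q
clusterVal : (b c : ℕ) → ℤ → PQ × PQ → ℤ → PQ
clusterVal b c k xy j with j ℤ.- k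
... | + n      = fwd b c n k xy
... | -[1+ n ] = bwd b c (suc n) k xy

-- Ring expressions in the generalised cluster variables x_j (j ∈ ℤ).
-- Every element of A(P_b,P_c) is represented by such an expression.

data Term : Set where
  var : ℤ → Term
  cst : ℤ → Term
  _⊕_ : Term → Term → Term
  _⊗_ : Term → Term → Term
  ⊖_  : Term → Term

eval : (ℤ → ℚ) → Term → ℚ
eval v (var j) = v j
eval v (cst n) = n ℚ./ 1
eval v (t ⊕ s) = eval v t ℚ.+ eval v s
eval v (t ⊗ s) = eval v t ℚ.* eval v s
eval v (⊖ t)   = ℚ.- eval v t

evalAt : (b c : ℕ) → ℤ → PQ × PQ → Term → ℚ
evalAt b c k xy = eval (λ j → toℚ (clusterVal b c k xy j))

-- Equality of the represented elements of A(P_b,P_c) ⊂ ℚ(x_1,x_2):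
-- the two rational functions in x_1, x_2 agree at every point with
-- x_1, x_2 positive rationals (a Zariski dense set on which every
-- x_j is defined and positive).
_≈[_,_]_ : Term → ℕ → ℕ → Term → Set
t ≈[ b , c ] s = ∀ (xy : PQ × PQ) → evalAt b c (+ 1) xy t ≡ evalAt b c (+ 1) xy s

record Frieze (b c : ℕ) : Set where
  field
    f     : Term → ℤ
    resp  : ∀ {t s} → t ≈[ b , c ] s → f t ≡ f s
    f-cst : ∀ n → f (cst n) ≡ n
    f-⊕   : ∀ t s → f (t ⊕ s) ≡ f t ℤ.+ f s
    f-⊗   : ∀ t s → f (t ⊗ s) ≡ f t ℤ.* f s
    f-⊖   : ∀ t → f (⊖ t) ≡ ℤ.- f t
    pos   : ∀ j → ℤ.0ℤ ℤ.< f (var j)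

open Frieze public

-- F is the restriction of ψ_x for the cluster x = (x_k, x_{k+1}):
-- on every element of A it agrees with evaluation at x_k = x_{k+1} = 1.
IsPsi : (b c : ℕ) → ℤ → Frieze b c → Set
IsPsi b c k F = ∀ t → (f F t ℚ./ 1) ≡ evalAt b c k (onePQ , onePQ) t

SameCluster : (b c : ℕ) → ℤ → ℤ → Set
SameCluster b c k l =
  (var k ≈[ b , c ] var l × var (k ℤ.+ ℤ.1ℤ) ≈[ b , c ] var (l ℤ.+ ℤ.1ℤ))
  ⊎ (var k ≈[ b , c ] var (l ℤ.+ ℤ.1ℤ) × var (k ℤ.+ ℤ.1ℤ) ≈[ b , c ] var l)

{-# OPTIONS --safe #-}

-- Write x_j for the generalised cluster variables and ψ_k for evaluation at x_k = x_{k+1} = 1.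
-- Started from two ones, the exchange relations x_n x_{n+2} = (1 + x_{n+1})^e only produce positive
-- integers: consecutive values p, q are coprime with p ∣ (1 + q)^e and q ∣ (1 + p)^e′, an invariant
-- that the exchange preserves, so every division is exact.  Positive solutions of the exchange
-- relations are determined by any two consecutive values, hence evaluation at x_k = x_{k+1} = 1 is
-- compatible with equality in A(P_b,P_c) (elements are compared at positive rational points) and
-- gives the frieze ψ_k.  If ψ_k and ψ_l agree then ψ_k(x_l) = ψ_k(x_{l+1}) = 1.  For bc ≥ 4 the
-- inequality x_n² ≤ x_{n+1}^e propagates along the sequence and keeps all other values ≥ 2, so
-- l = k.  For bc ≤ 3 (types A₂, B₂, G₂) the x_j are periodic in j, as explicit Laurent polynomials
-- show, and two consecutive ones recur only after full periods, so (x_l, x_{l+1}) = (x_k, x_{k+1}).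

module Submission where

open import Defs
open import Data.Nat using (ℕ; _≤_)
open import Data.Integer using (ℤ)
open import Data.Product using (Σ; ∃; _×_)
open import Relation.Nullary using (¬_)
open import Relation.Binary.PropositionalEquality using (_≢_)

open import Data.Empty using (⊥-elim)
import Data.Fin as Fin
import Data.Fin.Properties as Fin
open import Data.Integer as ℤ using (+_; -[1+_]; 1ℤ)
import Data.Integer.DivMod as ℤ
import Data.Integer.Properties as ℤ
import Data.Integer.Tactic.RingSolver as ℤ-Solver
open import Data.Nat as ℕ using (zero; suc)
import Data.Nat.DivMod as ℕ
import Data.Nat.Properties as ℕ
import Data.Nat.Tactic.RingSolver as ℕ-Solver
open import Data.Product using (Σ-syntax; ∃-syntax; _,_; proj₁; proj₂)
open import Data.Rational as ℚ using (ℚ; 0ℚ; 1ℚ)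
import Data.Rational.Properties as ℚ
open import Data.Rational.Unnormalised as ℚᵘ using (mkℚᵘ; *≡*)
import Data.Rational.Unnormalised.Properties as ℚᵘ
open import Data.Sum using (_⊎_; inj₁; inj₂; [_,_]′)
open import Level using (0ℓ)
open import Relation.Binary.PropositionalEquality
open import Relation.Nullary.Decidable using (Dec; yes; no; dec⇒maybe; from-yes; _→-dec_)
open import Tactic.RingSolver.Core.AlmostCommutativeRing
  using (AlmostCommutativeRing; fromCommutativeRing)

module _ where
  open import Data.Nat using (_+_; _*_; _^_; _<_; _/_; NonZero; ≢-nonZero⁻¹; >-nonZero; >-nonZero⁻¹)
  open import Data.Nat.Properties
  open import Data.Nat.DivMod using (m*[n/m]≡n)
  open import Data.Nat.Divisibility
    using (_∣_; divides; 1∣_; 0∣⇒≡0; ∣1⇒≡1; ∣m+n∣m⇒∣n; ∣m∣n⇒∣m+n; ∣n⇒∣m*n; ∣m⇒∣m*n; m∣m*n)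
  open import Data.Nat.Coprimality as Coprime using (Coprime; coprime-divisor; 1-coprimeTo)
  open import Data.Nat.Tactic.RingSolver using (solve-∀)
  open import Relation.Nullary using (contradiction)

  alternate : ℕ → ℕ → ℕ → ℕ
  alternate e₀ e₁ zero    = e₀
  alternate e₀ e₁ (suc n) = alternate e₁ e₀ n

  alternate-pair : ∀ {P : ℕ → ℕ → Set} {e₀ e₁} → P e₀ e₁ → P e₁ e₀ →
    ∀ n → P (alternate e₀ e₁ n) (alternate e₁ e₀ n)
  alternate-pair     p₀₁ p₁₀ zero    = p₀₁
  alternate-pair {P} p₀₁ p₁₀ (suc n) = alternate-pair {P} p₁₀ p₀₁ n

  binomial-mod : ∀ a q t e → ∃[ u ] (a + q * t) ^ e ≡ a ^ e + q * u
  binomial-mod a q t zero    = 0 , cong suc (sym (*-zeroʳ q))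
  binomial-mod a q t (suc e) with binomial-mod a q t e
  ... | u , eq = t * a ^ e + a * u + q * t * u ,
                 trans (cong ((a + q * t) *_) eq) (expand a q t (a ^ e) u)
    where
    expand : ∀ a q t w u → (a + q * t) * (w + q * u) ≡ a * w + q * (t * w + a * u + q * t * u)
    expand = solve-∀

  suc-^-mod : ∀ q e → ∃[ u ] suc q ^ e ≡ 1 + q * u
  suc-^-mod q e with binomial-mod 1 q 1 e
  ... | u , eq = u , subst₂ (λ a b → a ^ e ≡ b + q * u) (cong suc (*-identityʳ q)) (^-zeroˡ e) eq

  ^-distribʳ-* : ∀ m n e → (m * n) ^ e ≡ m ^ e * n ^ e
  ^-distribʳ-* m n zero    = refl
  ^-distribʳ-* m n (suc e) =
    trans (cong (m * n *_) (^-distribʳ-* m n e)) (shuffle m n (m ^ e) (n ^ e))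
    where
    shuffle : ∀ m n a b → m * n * (a * b) ≡ m * a * (n * b)
    shuffle = solve-∀

  coprime-divisor-^ : ∀ {q p x} e → Coprime q p → q ∣ p ^ e * x → q ∣ x
  coprime-divisor-^ {q} {p} {x} zero    _      q∣x = subst (q ∣_) (+-identityʳ x) q∣x
  coprime-divisor-^ {q} {p} {x} (suc e) coprime q∣ =
    coprime-divisor-^ e coprime (coprime-divisor coprime (subst (q ∣_) (*-assoc p (p ^ e) x) q∣))

  divisor-nonZero : ∀ {p m} → p ∣ m → NonZero m → NonZero p
  divisor-nonZero {zero}  p∣m m≢0 = contradiction (0∣⇒≡0 p∣m) (≢-nonZero⁻¹ _ {{m≢0}})
  divisor-nonZero {suc p} _   _   = _

  -- Consecutive values p = x_n, q = x_{n+1} of a sequence with x_n x_{n+2} = (1 + x_{n+1})^e₀ and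
  -- x_{n-1} x_{n+1} = (1 + x_n)^e₁; the first divisibility makes x_{n+2} = (1 + q)^e₀ / p exact.
  record Integral (e₀ e₁ p q : ℕ) : Set where
    field
      coprime : Coprime p q
      p∣      : p ∣ suc q ^ e₀
      q∣      : q ∣ suc p ^ e₁

  open Integral

  next : ∀ {e₀ e₁ p q} → Integral e₀ e₁ p q → ℕ
  next {e₀} {p = p} {q} g = (suc q ^ e₀ / p) {{divisor-nonZero (p∣ g) (m^n≢0 (suc q) e₀)}}

  next-exact : ∀ {e₀ e₁ p q} (g : Integral e₀ e₁ p q) → p * next g ≡ suc q ^ e₀
  next-exact {e₀} {q = q} g = m*[n/m]≡n {{divisor-nonZero (p∣ g) (m^n≢0 (suc q) e₀)}} (p∣ g)

  integral-step : ∀ {e₀ e₁ p q} (g : Integral e₀ e₁ p q) → Integral e₁ e₀ q (next g)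
  integral-step {e₀} {e₁} {p} {q} g = record
    { coprime = coprime-qr
    ; p∣      = q∣[1+r]^e₁
    ; q∣      = divides p (sym (next-exact g))
    }
    where
    r = next g
    t = proj₁ (suc-^-mod q e₀)
    p*r≡1+q*t : p * r ≡ 1 + q * t
    p*r≡1+q*t = trans (next-exact g) (proj₂ (suc-^-mod q e₀))
    coprime-qr : Coprime q r
    coprime-qr {i} (i∣q , i∣r) = ∣1⇒≡1 (∣m+n∣m⇒∣n
      (subst (i ∣_) (trans p*r≡1+q*t (+-comm 1 (q * t))) (∣n⇒∣m*n p i∣r)) (∣m⇒∣m*n t i∣q))
    u = proj₁ (binomial-mod (suc p) q t e₁)
    -- Modulo q, p^e₁ (1 + r)^e₁ = (p + 1 + q t)^e₁ is (1 + p)^e₁, which q divides.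
    p^e₁*[1+r]^e₁ : p ^ e₁ * suc r ^ e₁ ≡ suc p ^ e₁ + q * u
    p^e₁*[1+r]^e₁ = begin
      p ^ e₁ * suc r ^ e₁    ≡⟨ ^-distribʳ-* p (suc r) e₁ ⟨
      (p * suc r) ^ e₁       ≡⟨ cong (_^ e₁) (trans (*-suc p r) (cong (λ x → p + x) p*r≡1+q*t)) ⟩
      (p + (1 + q * t)) ^ e₁ ≡⟨ cong (_^ e₁) (+-suc p (q * t)) ⟩
      (suc p + q * t) ^ e₁   ≡⟨ proj₂ (binomial-mod (suc p) q t e₁) ⟩
      suc p ^ e₁ + q * u     ∎
      where open ≡-Reasoning
    q∣[1+r]^e₁ : q ∣ suc r ^ e₁
    q∣[1+r]^e₁ = coprime-divisor-^ e₁ (Coprime.sym (coprime g))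
      (subst (q ∣_) (sym p^e₁*[1+r]^e₁) (∣m∣n⇒∣m+n (q∣ g) (m∣m*n u)))

  Orbit : ℕ → ℕ → ℕ → Set
  Orbit e₀ e₁ n = Σ[ s ∈ ℕ × ℕ ] Integral (alternate e₀ e₁ n) (alternate e₁ e₀ n) (proj₁ s) (proj₂ s)

  orbit : ∀ e₀ e₁ n → Orbit e₀ e₁ n
  orbit e₀ e₁ zero    = (1 , 1) , record { coprime = 1-coprimeTo 1 ; p∣ = 1∣ _ ; q∣ = 1∣ _ }
  orbit e₀ e₁ (suc n) = step (orbit e₀ e₁ n)
    where
    step : Orbit e₀ e₁ n → Orbit e₀ e₁ (suc n)
    step ((p , q) , g) = (q , next g) , integral-step g

  -- x_n at x₀ = x₁ = 1 for the relations x_n x_{n+2} = (1 + x_{n+1})^(alternate e₀ e₁ n)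
  friezeSeq : ℕ → ℕ → ℕ → ℕ
  friezeSeq e₀ e₁ n = proj₁ (proj₁ (orbit e₀ e₁ n))

  friezeSeq-exchange : ∀ e₀ e₁ n → friezeSeq e₀ e₁ n * friezeSeq e₀ e₁ (suc (suc n))
                                    ≡ suc (friezeSeq e₀ e₁ (suc n)) ^ alternate e₀ e₁ n
  friezeSeq-exchange e₀ e₁ n = next-exact (proj₂ (orbit e₀ e₁ n))

  friezeSeq-nonZero : ∀ e₀ e₁ n → NonZero (friezeSeq e₀ e₁ n)
  friezeSeq-nonZero e₀ e₁ n = divisor-nonZero (p∣ (proj₂ (orbit e₀ e₁ n)))
    (m^n≢0 (suc (friezeSeq e₀ e₁ (suc n))) (alternate e₀ e₁ n))

  Growing : ℕ → ℕ → Set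
  Growing e₀ e₁ = 1 ≤ e₀ × 1 ≤ e₁ × 4 ≤ e₀ * e₁

  Growing-swap : ∀ {e₀ e₁} → Growing e₀ e₁ → Growing e₁ e₀
  Growing-swap {e₀} {e₁} (1≤e₀ , 1≤e₁ , 4≤e₀e₁) = 1≤e₁ , 1≤e₀ , subst (4 ≤_) (*-comm e₀ e₁) 4≤e₀e₁

  square-cancel-< : ∀ {m n} → m * m < n * n → m < n
  square-cancel-< mm<nn = ≰⇒> λ n≤m → <⇒≱ mm<nn (*-mono-≤ n≤m n≤m)

  -- From r² > q^e₀ (which p r = (1 + q)^e₀ and p² ≤ q^e₀ give) one gets r^(2e₁) > q^(e₀e₁) ≥ q⁴.
  growth-step : ∀ {e₀ e₁} p q r → Growing e₀ e₁ → 1 ≤ q →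
    p * p ≤ q ^ e₀ → p * r ≡ suc q ^ e₀ → q * q ≤ r ^ e₁ × 2 ≤ r
  growth-step {e₀} {e₁} p q r (1≤e₀ , 1≤e₁ , 4≤e₀e₁) 1≤q pp≤q^e₀ pr≡[1+q]^e₀ = <⇒≤ qq<r^e₁ , 2≤r
    where
    instance
      _ = >-nonZero 1≤e₀
      _ = >-nonZero 1≤e₁
      _ = >-nonZero 1≤q
    q^e₀<rr : q ^ e₀ < r * r
    q^e₀<rr = *-cancelˡ-< (q ^ e₀) (q ^ e₀) (r * r) (begin-strict
      q ^ e₀ * q ^ e₀           <⟨ *-mono-< (^-monoˡ-< e₀ (n<1+n q)) (^-monoˡ-< e₀ (n<1+n q)) ⟩
      suc q ^ e₀ * suc q ^ e₀   ≡⟨ cong₂ _*_ pr≡[1+q]^e₀ pr≡[1+q]^e₀ ⟨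
      p * r * (p * r)           ≡⟨ shuffle p r ⟩
      p * p * (r * r)           ≤⟨ *-monoˡ-≤ (r * r) pp≤q^e₀ ⟩
      q ^ e₀ * (r * r)          ∎)
      where
      open ≤-Reasoning
      shuffle : ∀ p r → p * r * (p * r) ≡ p * p * (r * r)
      shuffle = solve-∀
    2≤r : 2 ≤ r
    2≤r = ≰⇒> λ r≤1 → <⇒≱ (≤-<-trans (m^n>0 q e₀) q^e₀<rr) (*-mono-≤ r≤1 r≤1)
    qq<r^e₁ : q * q < r ^ e₁
    qq<r^e₁ = square-cancel-< (begin-strict
      q * q * (q * q)           ≡⟨ fourth q ⟩
      q ^ 4                     ≤⟨ ^-monoʳ-≤ q 4≤e₀e₁ ⟩
      q ^ (e₀ * e₁)             ≡⟨ ^-*-assoc q e₀ e₁ ⟨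
      (q ^ e₀) ^ e₁             <⟨ ^-monoˡ-< e₁ q^e₀<rr ⟩
      (r * r) ^ e₁              ≡⟨ ^-distribʳ-* r r e₁ ⟩
      r ^ e₁ * r ^ e₁           ∎)
      where
      open ≤-Reasoning
      fourth : ∀ q → q * q * (q * q) ≡ q * (q * (q * (q * 1)))
      fourth = solve-∀

  friezeSeq-≥2 : ∀ {e₀ e₁} → Growing e₀ e₁ → ∀ n → 2 ≤ friezeSeq e₀ e₁ (suc (suc n))
  friezeSeq-≥2 {e₀} {e₁} g n = proj₂ (step n)
    where
    x = friezeSeq e₀ e₁
    invariant : ∀ n → x n * x n ≤ x (suc n) ^ alternate e₀ e₁ n
    step : ∀ n → x (suc n) * x (suc n) ≤ x (suc (suc n)) ^ alternate e₁ e₀ n × 2 ≤ x (suc (suc n))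
    invariant zero    = ≤-reflexive (sym (^-zeroˡ (alternate e₀ e₁ 0)))
    invariant (suc n) = proj₁ (step n)
    step n = growth-step (x n) (x (suc n)) (x (suc (suc n)))
      (alternate-pair {P = Growing} g (Growing-swap g) n) (>-nonZero⁻¹ _ {{friezeSeq-nonZero e₀ e₁ (suc n)}})
      (invariant n) (friezeSeq-exchange e₀ e₁ n)

open import Data.Rational using (_+_; _*_)
open import Tactic.RingSolver using (solve-∀)

ℚ-ring : AlmostCommutativeRing 0ℓ 0ℓ
ℚ-ring = fromCommutativeRing ℚ.+-*-commutativeRing (λ q → dec⇒maybe (0ℚ ℚ.≟ q))

-- The ring's own `_^_`: the only exponentiation that `solve-∀ ℚ-ring` recognises.
open AlmostCommutativeRing ℚ-ring using (_^_)
open import Algebra.Properties.CommutativeSemiring.Exp.TCOptimised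
  (AlmostCommutativeRing.commutativeSemiring ℚ-ring) using (^-distrib-*; ^-homo-*)

*-pos : ∀ {p q} → 0ℚ ℚ.< p → 0ℚ ℚ.< q → 0ℚ ℚ.< p * q
*-pos {p} {q} p>0 q>0 =
  ℚ.positive⁻¹ (p * q) {{ℚ.pos*pos⇒pos p {{ℚ.positive p>0}} q {{ℚ.positive q>0}}}}

^-pos : ∀ {p} n → 0ℚ ℚ.< p → 0ℚ ℚ.< p ^ n
^-pos zero          p>0 = ℚ.positive⁻¹ 1ℚ
^-pos (suc zero)    p>0 = p>0
^-pos (suc (suc n)) p>0 = *-pos (^-pos (suc n) p>0) p>0

*-cancelʳ-pos : ∀ {p q r} → 0ℚ ℚ.< r → p * r ≡ q * r → p ≡ q
*-cancelʳ-pos {r = r} r>0 pr≡qr = ℚ.≤-antisym (cancel pr≡qr) (cancel (sym pr≡qr))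
  where
  cancel : ∀ {p q} → p * r ≡ q * r → p ℚ.≤ q
  cancel eq = ℚ.*-cancelʳ-≤-pos r {{ℚ.positive r>0}} (ℚ.≤-reflexive eq)

*-cancelˡ-pos : ∀ {p q r} → 0ℚ ℚ.< r → r * p ≡ r * q → p ≡ q
*-cancelˡ-pos {p} {q} {r} r>0 rp≡rq =
  *-cancelʳ-pos r>0 (trans (ℚ.*-comm p r) (trans rp≡rq (ℚ.*-comm r q)))

fromℚᵘ-homo-+ : ∀ p q → ℚ.fromℚᵘ (p ℚᵘ.+ q) ≡ ℚ.fromℚᵘ p + ℚ.fromℚᵘ q
fromℚᵘ-homo-+ p q = ℚ.toℚᵘ-injective (begin
  ℚ.toℚᵘ (ℚ.fromℚᵘ (p ℚᵘ.+ q))                   ≈⟨ ℚ.toℚᵘ-fromℚᵘ (p ℚᵘ.+ q) ⟩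
  p ℚᵘ.+ q                                        ≈⟨ ℚᵘ.+-cong (ℚ.toℚᵘ-fromℚᵘ p) (ℚ.toℚᵘ-fromℚᵘ q) ⟨
  ℚ.toℚᵘ (ℚ.fromℚᵘ p) ℚᵘ.+ ℚ.toℚᵘ (ℚ.fromℚᵘ q)   ≈⟨ ℚ.toℚᵘ-homo-+ (ℚ.fromℚᵘ p) (ℚ.fromℚᵘ q) ⟨
  ℚ.toℚᵘ (ℚ.fromℚᵘ p + ℚ.fromℚᵘ q)               ∎)
  where open ℚᵘ.≃-Reasoning

fromℚᵘ-homo-* : ∀ p q → ℚ.fromℚᵘ (p ℚᵘ.* q) ≡ ℚ.fromℚᵘ p * ℚ.fromℚᵘ q
fromℚᵘ-homo-* p q = ℚ.toℚᵘ-injective (begin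
  ℚ.toℚᵘ (ℚ.fromℚᵘ (p ℚᵘ.* q))                   ≈⟨ ℚ.toℚᵘ-fromℚᵘ (p ℚᵘ.* q) ⟩
  p ℚᵘ.* q                                        ≈⟨ ℚᵘ.*-cong (ℚ.toℚᵘ-fromℚᵘ p) (ℚ.toℚᵘ-fromℚᵘ q) ⟨
  ℚ.toℚᵘ (ℚ.fromℚᵘ p) ℚᵘ.* ℚ.toℚᵘ (ℚ.fromℚᵘ q)   ≈⟨ ℚ.toℚᵘ-homo-* (ℚ.fromℚᵘ p) (ℚ.fromℚᵘ q) ⟨
  ℚ.toℚᵘ (ℚ.fromℚᵘ p * ℚ.fromℚᵘ q)               ∎)
  where open ℚᵘ.≃-Reasoning

fromℚᵘ-homo‿- : ∀ p → ℚ.fromℚᵘ (ℚᵘ.- p) ≡ ℚ.- ℚ.fromℚᵘ p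
fromℚᵘ-homo‿- p = ℚ.toℚᵘ-injective (begin
  ℚ.toℚᵘ (ℚ.fromℚᵘ (ℚᵘ.- p))      ≈⟨ ℚ.toℚᵘ-fromℚᵘ (ℚᵘ.- p) ⟩
  ℚᵘ.- p                           ≈⟨ ℚᵘ.-‿cong (ℚ.toℚᵘ-fromℚᵘ p) ⟨
  ℚᵘ.- ℚ.toℚᵘ (ℚ.fromℚᵘ p)        ≈⟨ ℚ.toℚᵘ-homo‿- (ℚ.fromℚᵘ p) ⟨
  ℚ.toℚᵘ (ℚ.- ℚ.fromℚᵘ p)         ∎)
  where open ℚᵘ.≃-Reasoning

-- `i ℚ./ 1` unfolds to `fromℚᵘ (mkℚᵘ i 0)`.
/1-homo-+ : ∀ m n → (m ℤ.+ n) ℚ./ 1 ≡ m ℚ./ 1 + n ℚ./ 1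
/1-homo-+ m n = trans (ℚ.fromℚᵘ-cong {mkℚᵘ (m ℤ.+ n) 0} {mkℚᵘ m 0 ℚᵘ.+ mkℚᵘ n 0} (*≡* (eq m n)))
                      (fromℚᵘ-homo-+ (mkℚᵘ m 0) (mkℚᵘ n 0))
  where
  eq : ∀ m n → (m ℤ.+ n) ℤ.* + 1 ≡ (m ℤ.* + 1 ℤ.+ n ℤ.* + 1) ℤ.* + 1
  eq = ℤ-Solver.solve-∀

/1-homo-* : ∀ m n → (m ℤ.* n) ℚ./ 1 ≡ (m ℚ./ 1) * (n ℚ./ 1)
/1-homo-* m n = fromℚᵘ-homo-* (mkℚᵘ m 0) (mkℚᵘ n 0)

/1-homo‿- : ∀ n → (ℤ.- n) ℚ./ 1 ≡ ℚ.- (n ℚ./ 1)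
/1-homo‿- n = fromℚᵘ-homo‿- (mkℚᵘ n 0)

/1-injective : ∀ {m n} → m ℚ./ 1 ≡ n ℚ./ 1 → m ≡ n
/1-injective {m} {n} eq with ℚ.fromℚᵘ-injective {mkℚᵘ m 0} {mkℚᵘ n 0} eq
... | *≡* m*1≡n*1 = trans (sym (ℤ.*-identityʳ m)) (trans m*1≡n*1 (ℤ.*-identityʳ n))

-- Opaque, like `value` below, so that type checking never normalises the gcd computations in `_/_`.
opaque
  fromℕ : ℕ → ℚ
  fromℕ n = + n ℚ./ 1

  fromℕ-/1 : ∀ n → fromℕ n ≡ + n ℚ./ 1
  fromℕ-/1 n = refl

  fromℕ-1 : fromℕ 1 ≡ 1ℚ
  fromℕ-1 = refl

  fromℕ-homo-+ : ∀ m n → fromℕ (m ℕ.+ n) ≡ fromℕ m + fromℕ n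
  fromℕ-homo-+ m n = /1-homo-+ (+ m) (+ n)

  fromℕ-homo-* : ∀ m n → fromℕ (m ℕ.* n) ≡ fromℕ m * fromℕ n
  fromℕ-homo-* m n = trans (cong (ℚ._/ 1) (ℤ.pos-* m n)) (/1-homo-* (+ m) (+ n))

  fromℕ-injective : ∀ {m n} → fromℕ m ≡ fromℕ n → m ≡ n
  fromℕ-injective eq = ℤ.+-injective (/1-injective eq)

  fromℕ-pos : ∀ n → 0ℚ ℚ.< fromℕ (suc n)
  fromℕ-pos n = ℚ.positive⁻¹ _ {{ℚ.normalize-pos (suc n) 1}}

fromℕ-homo-^ : ∀ m n → fromℕ (m ℕ.^ n) ≡ fromℕ m ^ n
fromℕ-homo-^ m zero    = fromℕ-1
fromℕ-homo-^ m (suc n) = begin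
  fromℕ (m ℕ.* m ℕ.^ n)      ≡⟨ fromℕ-homo-* m (m ℕ.^ n) ⟩
  fromℕ m * fromℕ (m ℕ.^ n)  ≡⟨ cong (fromℕ m *_) (fromℕ-homo-^ m n) ⟩
  fromℕ m * fromℕ m ^ n      ≡⟨ ^-homo-* (fromℕ m) 1 n ⟨
  fromℕ m ^ suc n            ∎
  where open ≡-Reasoning

fromℕ-suc-pow⁺ : ∀ u e → fromℕ (suc (pow⁺ u e)) ≡ fromℕ (suc u) ^ e
fromℕ-suc-pow⁺ u zero    = fromℕ-1
fromℕ-suc-pow⁺ u (suc e) = begin
  fromℕ (suc u ℕ.* suc (pow⁺ u e))       ≡⟨ fromℕ-homo-* (suc u) (suc (pow⁺ u e)) ⟩
  fromℕ (suc u) * fromℕ (suc (pow⁺ u e)) ≡⟨ cong (fromℕ (suc u) *_) (fromℕ-suc-pow⁺ u e) ⟩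
  fromℕ (suc u) * fromℕ (suc u) ^ e      ≡⟨ ^-homo-* (fromℕ (suc u)) 1 e ⟨
  fromℕ (suc u) ^ suc e                  ∎
  where open ≡-Reasoning

-- `v = n / d` with `d > 0`.  Like `Exchange` below, a record so that its indices can be inferred.
record Fraction (v n d : ℚ) : Set where
  field
    denominator>0     : 0ℚ ℚ.< d
    value*denominator : v * d ≡ n

open Fraction

opaque
  unfolding fromℕ

  value : PQ → ℚ
  value = toℚ

  value≡toℚ : ∀ x → value x ≡ toℚ x
  value≡toℚ x = refl

  value-one : value onePQ ≡ fromℕ 1
  value-one = refl

  value-pos : ∀ x → 0ℚ ℚ.< value x
  value-pos (a , d) = ℚ.positive⁻¹ _ {{ℚ.normalize-pos (suc a) (suc d)}}

  value-fraction : ∀ a d → Fraction (value (a , d)) (fromℕ (suc a)) (fromℕ (suc d))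
  value-fraction a d = record
    { denominator>0     = fromℕ-pos d
    ; value*denominator = begin
        toℚ (a , d) * fromℕ (suc d)
          ≡⟨ fromℚᵘ-homo-* (mkℚᵘ (+ suc a) d) (mkℚᵘ (+ suc d) 0) ⟨
        ℚ.fromℚᵘ (mkℚᵘ (+ suc a) d ℚᵘ.* mkℚᵘ (+ suc d) 0)
          ≡⟨ ℚ.fromℚᵘ-cong {mkℚᵘ (+ suc a) d ℚᵘ.* mkℚᵘ (+ suc d) 0} {mkℚᵘ (+ suc a) 0}
                           (*≡* (cong +_ (eq a d))) ⟩
        fromℕ (suc a)
          ∎
    }
    where
    open ≡-Reasoning
    eq : ∀ a d → suc a ℕ.* suc d ℕ.* 1 ≡ suc a ℕ.* suc (d ℕ.* 1)
    eq = ℕ-Solver.solve-∀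

[1+b]^e*db^e : ∀ {b nb db} e → Fraction b nb db → (1ℚ + b) ^ e * db ^ e ≡ (db + nb) ^ e
[1+b]^e*db^e {b} {nb} {db} e b≡nb/db = begin
  (1ℚ + b) ^ e * db ^ e  ≡⟨ ^-distrib-* (1ℚ + b) db e ⟨
  ((1ℚ + b) * db) ^ e    ≡⟨ cong (_^ e) (distrib b db) ⟩
  (db + b * db) ^ e      ≡⟨ cong (λ t → (db + t) ^ e) (value*denominator b≡nb/db) ⟩
  (db + nb) ^ e          ∎
  where
  open ≡-Reasoning
  distrib : ∀ b db → (1ℚ + b) * db ≡ db + b * db
  distrib = solve-∀ ℚ-ring

exchange⇒fraction : ∀ {a b c na nb nc da db dc} e → 0ℚ ℚ.< a → 0ℚ ℚ.< dc →
  Fraction a na da → Fraction b nb db → da * dc * (db + nb) ^ e ≡ na * nc * db ^ e →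
  a * c ≡ (1ℚ + b) ^ e → Fraction c nc dc
exchange⇒fraction {a} {b} {c} {na} {nb} {nc} {da} {db} {dc} e a>0 dc>0 a≡na/da b≡nb/db identity ac≡ =
  record { denominator>0 = dc>0 ; value*denominator = c*dc≡nc }
  where
  open ≡-Reasoning
  shuffle : ∀ a c da dc w → c * dc * (a * da * w) ≡ da * dc * (a * c * w)
  shuffle = solve-∀ ℚ-ring
  shuffle′ : ∀ n c w → n * c * w ≡ c * (n * w)
  shuffle′ = solve-∀ ℚ-ring
  c*dc≡nc : c * dc ≡ nc
  c*dc≡nc = *-cancelʳ-pos (*-pos (*-pos a>0 (denominator>0 a≡na/da)) (^-pos e (denominator>0 b≡nb/db)))
    (begin
      c * dc * (a * da * db ^ e)          ≡⟨ shuffle a c da dc (db ^ e) ⟩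
      da * dc * (a * c * db ^ e)          ≡⟨ cong (λ t → da * dc * (t * db ^ e)) ac≡ ⟩
      da * dc * ((1ℚ + b) ^ e * db ^ e)   ≡⟨ cong (da * dc *_) ([1+b]^e*db^e e b≡nb/db) ⟩
      da * dc * (db + nb) ^ e             ≡⟨ identity ⟩
      na * nc * db ^ e                    ≡⟨ cong (λ t → t * nc * db ^ e) (value*denominator a≡na/da) ⟨
      a * da * nc * db ^ e                ≡⟨ shuffle′ (a * da) nc (db ^ e) ⟩
      nc * (a * da * db ^ e)              ∎)

fraction⇒exchange : ∀ {a b c na nb nc da db dc} e → Fraction a na da → Fraction b nb db →
  Fraction c nc dc → da * dc * (db + nb) ^ e ≡ na * nc * db ^ e → a * c ≡ (1ℚ + b) ^ e
fraction⇒exchange {a} {b} {c} {na} {nb} {nc} {da} {db} {dc} e a≡na/da b≡nb/db c≡nc/dc identity =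
  *-cancelʳ-pos (*-pos (*-pos (denominator>0 a≡na/da) (denominator>0 c≡nc/dc))
                       (^-pos e (denominator>0 b≡nb/db))) (begin
    a * c * (da * dc * db ^ e)          ≡⟨ shuffle a c da dc (db ^ e) ⟩
    a * da * (c * dc) * db ^ e          ≡⟨ cong₂ (λ s t → s * t * db ^ e) (value*denominator a≡na/da)
                                                                           (value*denominator c≡nc/dc) ⟩
    na * nc * db ^ e                    ≡⟨ identity ⟨
    da * dc * (db + nb) ^ e             ≡⟨ cong (da * dc *_) ([1+b]^e*db^e e b≡nb/db) ⟨
    da * dc * ((1ℚ + b) ^ e * db ^ e)   ≡⟨ shuffle′ (da * dc) ((1ℚ + b) ^ e) (db ^ e) ⟩
    (1ℚ + b) ^ e * (da * dc * db ^ e)   ∎)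
  where
  open ≡-Reasoning
  shuffle : ∀ a c da dc w → a * c * (da * dc * w) ≡ a * da * (c * dc) * w
  shuffle = solve-∀ ℚ-ring
  shuffle′ : ∀ d p w → d * (p * w) ≡ p * (d * w)
  shuffle′ = solve-∀ ℚ-ring

exch-exchange : ∀ e x y → value x * value (exch e x y) ≡ (1ℚ + value y) ^ e
exch-exchange e (a , b) (p , q) =
  fraction⇒exchange e (value-fraction a b) (value-fraction p q) (value-fraction n d) identity
  where
  open ≡-Reasoning
  n = mul⁺ (pow⁺ (suc (p ℕ.+ q)) e) b
  d = mul⁺ (pow⁺ q e) a
  A = fromℕ (suc a); B = fromℕ (suc b); P = fromℕ (suc p); Q = fromℕ (suc q)
  2+p+q : ∀ p q → suc (suc (p ℕ.+ q)) ≡ suc q ℕ.+ suc p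
  2+p+q = ℕ-Solver.solve-∀
  d≡ : fromℕ (suc d) ≡ Q ^ e * A
  d≡ = trans (fromℕ-homo-* (suc (pow⁺ q e)) (suc a)) (cong (_* A) (fromℕ-suc-pow⁺ q e))
  n≡ : fromℕ (suc n) ≡ (Q + P) ^ e * B
  n≡ = begin
    fromℕ (suc (pow⁺ (suc (p ℕ.+ q)) e) ℕ.* suc b)
      ≡⟨ fromℕ-homo-* (suc (pow⁺ (suc (p ℕ.+ q)) e)) (suc b) ⟩
    fromℕ (suc (pow⁺ (suc (p ℕ.+ q)) e)) * B
      ≡⟨ cong (_* B) (fromℕ-suc-pow⁺ (suc (p ℕ.+ q)) e) ⟩
    fromℕ (suc (suc (p ℕ.+ q))) ^ e * B
      ≡⟨ cong (λ m → fromℕ m ^ e * B) (2+p+q p q) ⟩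
    fromℕ (suc q ℕ.+ suc p) ^ e * B
      ≡⟨ cong (λ t → t ^ e * B) (fromℕ-homo-+ (suc q) (suc p)) ⟩
    (Q + P) ^ e * B
      ∎
  shuffle : ∀ A B u w → B * (u * A) * w ≡ A * (w * B) * u
  shuffle = solve-∀ ℚ-ring
  identity : B * fromℕ (suc d) * (Q + P) ^ e ≡ A * fromℕ (suc n) * Q ^ e
  identity = begin
    B * fromℕ (suc d) * (Q + P) ^ e   ≡⟨ cong (λ t → B * t * (Q + P) ^ e) d≡ ⟩
    B * (Q ^ e * A) * (Q + P) ^ e     ≡⟨ shuffle A B (Q ^ e) ((Q + P) ^ e) ⟩
    A * ((Q + P) ^ e * B) * Q ^ e     ≡⟨ cong (λ t → A * t * Q ^ e) n≡ ⟨
    A * fromℕ (suc n) * Q ^ e         ∎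

record Exchange (e : ℤ → ℕ) (v : ℤ → ℚ) : Set where
  constructor mkExchange
  field exchange : ∀ j → v j * v (j ℤ.+ 1ℤ ℤ.+ 1ℤ) ≡ (1ℚ + v (j ℤ.+ 1ℤ)) ^ e j

record Exchangeℕ (e : ℕ → ℕ) (u : ℕ → ℚ) : Set where
  constructor mkExchangeℕ
  field exchangeℕ : ∀ n → u n * u (suc (suc n)) ≡ (1ℚ + u (suc n)) ^ e n

open Exchange
open Exchangeℕ

Exchange-cong-exponent : ∀ {e e′ v} → (∀ j → e j ≡ e′ j) → Exchange e v → Exchange e′ v
Exchange-cong-exponent {v = v} e≗e′ ex = mkExchange λ j →
  subst (λ m → v j * v (j ℤ.+ 1ℤ ℤ.+ 1ℤ) ≡ (1ℚ + v (j ℤ.+ 1ℤ)) ^ m) (e≗e′ j) (exchange ex j)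

Exchangeℕ-cong-exponent : ∀ {e e′ u} → (∀ n → e n ≡ e′ n) → Exchangeℕ e u → Exchangeℕ e′ u
Exchangeℕ-cong-exponent {u = u} e≗e′ ex = mkExchangeℕ λ n →
  subst (λ m → u n * u (suc (suc n)) ≡ (1ℚ + u (suc n)) ^ m) (e≗e′ n) (exchangeℕ ex n)

Exchangeℕ-cong-values : ∀ {e u w} → (∀ n → u n ≡ w n) → Exchangeℕ e u → Exchangeℕ e w
Exchangeℕ-cong-values {e} u≗w ex = mkExchangeℕ λ n →
  trans (cong₂ _*_ (sym (u≗w n)) (sym (u≗w (suc (suc n)))))
        (trans (exchangeℕ ex n) (cong (λ t → (1ℚ + t) ^ e n) (u≗w (suc n))))

exchangeℕ-unique : ∀ {e u w} → Exchangeℕ e u → Exchangeℕ e w → (∀ n → 0ℚ ℚ.< u n) →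
  u 0 ≡ w 0 → u 1 ≡ w 1 → ∀ n → u n ≡ w n
exchangeℕ-unique {e} {u} {w} exu exw u>0 u₀≡w₀ u₁≡w₁ n = proj₁ (agree n)
  where
  agree : ∀ n → u n ≡ w n × u (suc n) ≡ w (suc n)
  agree zero    = u₀≡w₀ , u₁≡w₁
  agree (suc n) with agree n
  ... | uₙ≡wₙ , uₙ₊₁≡wₙ₊₁ = uₙ₊₁≡wₙ₊₁ , *-cancelˡ-pos (u>0 n) (begin
    u n * u (suc (suc n))    ≡⟨ exchangeℕ exu n ⟩
    (1ℚ + u (suc n)) ^ e n   ≡⟨ cong (λ t → (1ℚ + t) ^ e n) uₙ₊₁≡wₙ₊₁ ⟩
    (1ℚ + w (suc n)) ^ e n   ≡⟨ exchangeℕ exw n ⟨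
    w n * w (suc (suc n))    ≡⟨ cong (_* w (suc (suc n))) uₙ≡wₙ ⟨
    u n * w (suc (suc n))    ∎)
    where open ≡-Reasoning

-- `+ suc n` computes from `1ℤ ℤ.+ + n`, so these follow from ring identities in `m = + n`.
k+n+1≡k+[1+n] : ∀ k n → k ℤ.+ + n ℤ.+ 1ℤ ≡ k ℤ.+ + suc n
k+n+1≡k+[1+n] k n = lemma k (+ n)
  where
  lemma : ∀ k m → k ℤ.+ m ℤ.+ 1ℤ ≡ k ℤ.+ (1ℤ ℤ.+ m)
  lemma = ℤ-Solver.solve-∀

k+1+n≡k+[1+n] : ∀ k n → k ℤ.+ 1ℤ ℤ.+ + n ≡ k ℤ.+ + suc n
k+1+n≡k+[1+n] k n = lemma k (+ n)
  where
  lemma : ∀ k m → k ℤ.+ 1ℤ ℤ.+ m ≡ k ℤ.+ (1ℤ ℤ.+ m)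
  lemma = ℤ-Solver.solve-∀

k-[1+n]+1≡k-n : ∀ k n → k ℤ.- + suc n ℤ.+ 1ℤ ≡ k ℤ.- + n
k-[1+n]+1≡k-n k n = lemma k (+ n)
  where
  lemma : ∀ k m → k ℤ.- (1ℤ ℤ.+ m) ℤ.+ 1ℤ ≡ k ℤ.- m
  lemma = ℤ-Solver.solve-∀

k+1-[1+n]≡k-n : ∀ k n → k ℤ.+ 1ℤ ℤ.- + suc n ≡ k ℤ.- + n
k+1-[1+n]≡k-n k n = lemma k (+ n)
  where
  lemma : ∀ k m → k ℤ.+ 1ℤ ℤ.- (1ℤ ℤ.+ m) ≡ k ℤ.- m
  lemma = ℤ-Solver.solve-∀

k-1-[2+n]≡k-[3+n] : ∀ k n → k ℤ.- 1ℤ ℤ.- + suc (suc n) ≡ k ℤ.- + suc (suc (suc n))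
k-1-[2+n]≡k-[3+n] k n = lemma k (+ n)
  where
  lemma : ∀ k m → k ℤ.- 1ℤ ℤ.- (1ℤ ℤ.+ (1ℤ ℤ.+ m)) ≡ k ℤ.- (1ℤ ℤ.+ (1ℤ ℤ.+ (1ℤ ℤ.+ m)))
  lemma = ℤ-Solver.solve-∀

k+m-k≡m : ∀ k m → k ℤ.+ m ℤ.- k ≡ m
k+m-k≡m = ℤ-Solver.solve-∀

k+1-m-k≡1-m : ∀ k m → k ℤ.+ 1ℤ ℤ.- m ℤ.- k ≡ 1ℤ ℤ.- m
k+1-m-k≡1-m = ℤ-Solver.solve-∀

k-1-1≡k-2 : ∀ k → k ℤ.- 1ℤ ℤ.- 1ℤ ≡ k ℤ.- + 2
k-1-1≡k-2 = ℤ-Solver.solve-∀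

k+1-2≡k-1 : ∀ k → k ℤ.+ 1ℤ ℤ.- + 2 ≡ k ℤ.- 1ℤ
k+1-2≡k-1 = ℤ-Solver.solve-∀

k-1+1≡k : ∀ k → k ℤ.- 1ℤ ℤ.+ 1ℤ ≡ k
k-1+1≡k = ℤ-Solver.solve-∀

k+1-1≡k : ∀ k → k ℤ.+ 1ℤ ℤ.- 1ℤ ≡ k
k+1-1≡k = ℤ-Solver.solve-∀

data Around (k : ℤ) : ℤ → Set where
  ahead  : ∀ n → Around k (k ℤ.+ + n)
  behind : ∀ n → Around k (k ℤ.+ 1ℤ ℤ.- + suc (suc n))

around : ∀ k j → Around k j
around k j = subst (Around k) (k+[j-k]≡j k j) (split (j ℤ.- k))
  where
  k+[j-k]≡j : ∀ k j → k ℤ.+ (j ℤ.- k) ≡ j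
  k+[j-k]≡j = ℤ-Solver.solve-∀
  split : ∀ d → Around k (k ℤ.+ d)
  split (+ n)    = ahead n
  split -[1+ n ] = subst (Around k) (ℤ.+-assoc k 1ℤ (ℤ.- + suc (suc n))) (behind n)

module _ {e : ℤ → ℕ} {v : ℤ → ℚ} where

  private
    k+n+1+1≡k+[2+n] : ∀ k n → k ℤ.+ + n ℤ.+ 1ℤ ℤ.+ 1ℤ ≡ k ℤ.+ + suc (suc n)
    k+n+1+1≡k+[2+n] k n = trans (cong (ℤ._+ 1ℤ) (k+n+1≡k+[1+n] k n)) (k+n+1≡k+[1+n] k (suc n))

    k-[2+n]+1+1≡k-n : ∀ k n → k ℤ.- + suc (suc n) ℤ.+ 1ℤ ℤ.+ 1ℤ ≡ k ℤ.- + n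
    k-[2+n]+1+1≡k-n k n = trans (cong (ℤ._+ 1ℤ) (k-[1+n]+1≡k-n k (suc n))) (k-[1+n]+1≡k-n k n)

  exchange-forward : Exchange e v → ∀ k → Exchangeℕ (λ n → e (k ℤ.+ + n)) (λ n → v (k ℤ.+ + n))
  exchange-forward ex k = mkExchangeℕ λ n →
    subst₂ (λ i j → v (k ℤ.+ + n) * v j ≡ (1ℚ + v i) ^ e (k ℤ.+ + n))
           (k+n+1≡k+[1+n] k n) (k+n+1+1≡k+[2+n] k n) (exchange ex (k ℤ.+ + n))

  exchange-backward : Exchange e v → ∀ k →
    Exchangeℕ (λ n → e (k ℤ.- + suc (suc n))) (λ n → v (k ℤ.- + n))
  exchange-backward ex k = mkExchangeℕ λ n →
    subst₂ (λ i j → v j * v (k ℤ.- + suc (suc n)) ≡ (1ℚ + v i) ^ e (k ℤ.- + suc (suc n)))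
           (k-[1+n]+1≡k-n k (suc n)) (k-[2+n]+1+1≡k-n k n)
           (trans (ℚ.*-comm (v (k ℤ.- + suc (suc n) ℤ.+ 1ℤ ℤ.+ 1ℤ)) (v (k ℤ.- + suc (suc n))))
                  (exchange ex (k ℤ.- + suc (suc n))))

  -- Every triple j, j + 1, j + 2 lies in [k, ∞) or in (-∞, k + 1].
  exchange-glue : ∀ k → Exchangeℕ (λ n → e (k ℤ.+ + n)) (λ n → v (k ℤ.+ + n)) →
    Exchangeℕ (λ n → e (k ℤ.+ 1ℤ ℤ.- + suc (suc n))) (λ n → v (k ℤ.+ 1ℤ ℤ.- + n)) →
    Exchange e v
  exchange-glue k fwd bwd = mkExchange glued
    where
    glued : ∀ j → v j * v (j ℤ.+ 1ℤ ℤ.+ 1ℤ) ≡ (1ℚ + v (j ℤ.+ 1ℤ)) ^ e j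
    glued j with around k j
    ... | ahead n  =
      subst₂ (λ i j → v (k ℤ.+ + n) * v j ≡ (1ℚ + v i) ^ e (k ℤ.+ + n))
             (sym (k+n+1≡k+[1+n] k n)) (sym (k+n+1+1≡k+[2+n] k n)) (exchangeℕ fwd n)
    ... | behind n =
      subst₂ (λ i j → v m * v j ≡ (1ℚ + v i) ^ e m)
             (sym (k-[1+n]+1≡k-n (k ℤ.+ 1ℤ) (suc n))) (sym (k-[2+n]+1+1≡k-n (k ℤ.+ 1ℤ) n))
             (trans (ℚ.*-comm (v m) (v (k ℤ.+ 1ℤ ℤ.- + n))) (exchangeℕ bwd n))
      where m = k ℤ.+ 1ℤ ℤ.- + suc (suc n)

exchange-unique : ∀ {e v w} → Exchange e v → Exchange e w → (∀ j → 0ℚ ℚ.< v j) →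
  ∀ k → v k ≡ w k → v (k ℤ.+ 1ℤ) ≡ w (k ℤ.+ 1ℤ) → ∀ j → v j ≡ w j
exchange-unique {e} {v} {w} exv exw v>0 k vₖ≡wₖ vₖ₊₁≡wₖ₊₁ j = agree (around k j)
  where
  at = subst (λ i → v i ≡ w i)
  agree : ∀ {j} → Around k j → v j ≡ w j
  agree (ahead n)  = exchangeℕ-unique (exchange-forward exv k) (exchange-forward exw k) (λ _ → v>0 _)
    (at (sym (ℤ.+-identityʳ k)) vₖ≡wₖ) vₖ₊₁≡wₖ₊₁ n
  agree (behind n) = exchangeℕ-unique
    (exchange-backward exv (k ℤ.+ 1ℤ)) (exchange-backward exw (k ℤ.+ 1ℤ)) (λ _ → v>0 _)
    (at (sym (ℤ.+-identityʳ (k ℤ.+ 1ℤ))) vₖ₊₁≡wₖ₊₁) (at (sym (k+1-1≡k k)) vₖ≡wₖ) (suc (suc n))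

exchange-shift : ∀ {e v} → Exchange e v → ∀ m → Exchange (λ j → e (j ℤ.+ m)) (λ j → v (j ℤ.+ m))
exchange-shift {e} {v} ex m = mkExchange λ j →
  subst₂ (λ i k → v (j ℤ.+ m) * v k ≡ (1ℚ + v i) ^ e (j ℤ.+ m))
         (shift₁ j m) (shift₂ j m) (exchange ex (j ℤ.+ m))
  where
  shift₁ : ∀ j m → j ℤ.+ m ℤ.+ 1ℤ ≡ j ℤ.+ 1ℤ ℤ.+ m
  shift₁ = ℤ-Solver.solve-∀
  shift₂ : ∀ j m → j ℤ.+ m ℤ.+ 1ℤ ℤ.+ 1ℤ ≡ j ℤ.+ 1ℤ ℤ.+ 1ℤ ℤ.+ m
  shift₂ = ℤ-Solver.solve-∀

exchange-periodic : ∀ {e v} p → Exchange e v → (∀ j → 0ℚ ℚ.< v j) → (∀ j → e (j ℤ.+ + p) ≡ e j) →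
  ∀ m → v (m ℤ.+ + p) ≡ v m → v (m ℤ.+ 1ℤ ℤ.+ + p) ≡ v (m ℤ.+ 1ℤ) → ∀ j → v (j ℤ.+ + p) ≡ v j
exchange-periodic p ex v>0 e-periodic =
  exchange-unique (Exchange-cong-exponent e-periodic (exchange-shift ex (+ p))) ex (λ _ → v>0 _)

periodic-multiple : ∀ {A : Set} {f : ℤ → A} p → (∀ j → f (j ℤ.+ + p) ≡ f j) →
  ∀ j q → f (j ℤ.+ q ℤ.* + p) ≡ f j
periodic-multiple {f = f} p f-periodic j (+ n) =
  trans (cong (λ i → f (j ℤ.+ i)) (sym (ℤ.pos-* n p))) (ℕ-multiple j n)
  where
  ℕ-multiple : ∀ j n → f (j ℤ.+ + (n ℕ.* p)) ≡ f j
  ℕ-multiple j zero    = cong f (ℤ.+-identityʳ j)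
  ℕ-multiple j (suc n) =
    trans (cong f (rearrange j (+ p) (+ (n ℕ.* p)))) (trans (f-periodic _) (ℕ-multiple j n))
    where
    rearrange : ∀ j a b → j ℤ.+ (a ℤ.+ b) ≡ j ℤ.+ b ℤ.+ a
    rearrange = ℤ-Solver.solve-∀
periodic-multiple {f = f} p f-periodic j -[1+ n ] =
  sym (trans (cong f (cancel j (+ suc n) (+ p)))
             (periodic-multiple p f-periodic (j ℤ.+ -[1+ n ] ℤ.* + p) (+ suc n)))
  where
  cancel : ∀ j m q → j ≡ j ℤ.+ (ℤ.- m) ℤ.* q ℤ.+ m ℤ.* q
  cancel = ℤ-Solver.solve-∀

suc-suc-%2 : ∀ n → suc (suc n) ℕ.% 2 ≡ n ℕ.% 2
suc-suc-%2 n = trans (cong (ℕ._% 2) (ℕ.+-comm 2 n)) (ℕ.[m+n]%n≡m%n n 2)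

parity-flip : ∀ n → (n ℕ.% 2 ≡ 0 × suc n ℕ.% 2 ≡ 1) ⊎ (n ℕ.% 2 ≡ 1 × suc n ℕ.% 2 ≡ 0)
parity-flip zero = inj₁ (refl , refl)
parity-flip (suc n) with parity-flip n
... | inj₁ (n-even , 1+n-odd) = inj₂ (1+n-odd , trans (suc-suc-%2 n) n-even)
... | inj₂ (n-odd , 1+n-even) = inj₁ (1+n-even , trans (suc-suc-%2 n) n-odd)

isOdd-flip : ∀ j → (isOdd j ≡ 0 × isOdd (j ℤ.+ 1ℤ) ≡ 1) ⊎ (isOdd j ≡ 1 × isOdd (j ℤ.+ 1ℤ) ≡ 0)
isOdd-flip (+ n)       = subst (λ m → (n ℕ.% 2 ≡ 0 × m ℕ.% 2 ≡ 1) ⊎ (n ℕ.% 2 ≡ 1 × m ℕ.% 2 ≡ 0))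
                               (ℕ.+-comm 1 n) (parity-flip n)
isOdd-flip -[1+ zero ] = inj₂ (refl , refl)
isOdd-flip -[1+ suc n ] with parity-flip (suc n)
... | inj₁ (n-even , 1+n-odd) = inj₂ (1+n-odd , n-even)
... | inj₂ (n-odd , 1+n-even) = inj₁ (1+n-even , n-odd)

expo-cases : ∀ b c k →
  (expo b c k ≡ b × expo b c (k ℤ.+ 1ℤ) ≡ c) ⊎ (expo b c k ≡ c × expo b c (k ℤ.+ 1ℤ) ≡ b)
expo-cases b c k with isOdd-flip k
... | inj₁ (k-even , k+1-odd) rewrite k-even | k+1-odd = inj₁ (refl , refl)
... | inj₂ (k-odd , k+1-even) rewrite k-odd | k+1-even = inj₂ (refl , refl)

expo-suc : ∀ b c j → expo b c (j ℤ.+ 1ℤ) ≡ expo c b j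
expo-suc b c j with isOdd-flip j
... | inj₁ (j-even , j+1-odd) rewrite j-even | j+1-odd = refl
... | inj₂ (j-odd , j+1-even) rewrite j-odd | j+1-even = refl

expo-+2 : ∀ b c j → expo b c (j ℤ.+ 1ℤ ℤ.+ 1ℤ) ≡ expo b c j
expo-+2 b c j = trans (expo-suc b c (j ℤ.+ 1ℤ)) (expo-suc c b j)

expo-periodic : ∀ b c j → expo b c (j ℤ.+ + 2) ≡ expo b c j
expo-periodic b c j = trans (cong (expo b c) (sym (k+n+1≡k+[1+n] j 1))) (expo-+2 b c j)

expo-diagonal : ∀ b j → expo b b j ≡ b
expo-diagonal b j with isOdd j
... | zero  = refl
... | suc _ = refl

expo-−1 : ∀ b c k → expo b c (k ℤ.- 1ℤ) ≡ expo b c (k ℤ.+ 1ℤ)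
expo-−1 b c k = trans (sym (expo-+2 b c (k ℤ.- 1ℤ))) (cong (λ i → expo b c (i ℤ.+ 1ℤ)) (k-1+1≡k k))

expo-ahead : ∀ b c k n → expo b c (k ℤ.+ + n) ≡ alternate (expo b c k) (expo b c (k ℤ.+ 1ℤ)) n
expo-ahead b c k zero    = cong (expo b c) (ℤ.+-identityʳ k)
expo-ahead b c k (suc n) = begin
  expo b c (k ℤ.+ + suc n)
    ≡⟨ cong (expo b c) (k+1+n≡k+[1+n] k n) ⟨
  expo b c (k ℤ.+ 1ℤ ℤ.+ + n)
    ≡⟨ expo-ahead b c (k ℤ.+ 1ℤ) n ⟩
  alternate (expo b c (k ℤ.+ 1ℤ)) (expo b c (k ℤ.+ 1ℤ ℤ.+ 1ℤ)) n
    ≡⟨ cong (λ e → alternate (expo b c (k ℤ.+ 1ℤ)) e n) (expo-+2 b c k) ⟩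
  alternate (expo b c (k ℤ.+ 1ℤ)) (expo b c k) n
    ∎
  where open ≡-Reasoning

expo-behind : ∀ b c k n →
  expo b c (k ℤ.+ 1ℤ ℤ.- + suc (suc n)) ≡ alternate (expo b c (k ℤ.+ 1ℤ)) (expo b c k) n
expo-behind b c k zero    = begin
  expo b c (k ℤ.+ 1ℤ ℤ.- + 2)   ≡⟨ cong (expo b c) (k+1-2≡k-1 k) ⟩
  expo b c (k ℤ.- 1ℤ)           ≡⟨ expo-−1 b c k ⟩
  expo b c (k ℤ.+ 1ℤ)           ∎
  where open ≡-Reasoning
expo-behind b c k (suc n) = begin
  expo b c (k ℤ.+ 1ℤ ℤ.- + suc (suc (suc n)))      ≡⟨ cong (expo b c) (shift k (+ n)) ⟩
  expo b c (k ℤ.- 1ℤ ℤ.+ 1ℤ ℤ.- + suc (suc n))     ≡⟨ expo-behind b c (k ℤ.- 1ℤ) n ⟩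
  alternate (expo b c (k ℤ.- 1ℤ ℤ.+ 1ℤ)) (expo b c (k ℤ.- 1ℤ)) n
    ≡⟨ cong₂ (λ e e′ → alternate e e′ n) (cong (expo b c) (k-1+1≡k k)) (expo-−1 b c k) ⟩
  alternate (expo b c k) (expo b c (k ℤ.+ 1ℤ)) n  ∎
  where
  open ≡-Reasoning
  shift : ∀ k m → k ℤ.+ 1ℤ ℤ.- (1ℤ ℤ.+ (1ℤ ℤ.+ (1ℤ ℤ.+ m))) ≡ k ℤ.- 1ℤ ℤ.+ 1ℤ ℤ.- (1ℤ ℤ.+ (1ℤ ℤ.+ m))
  shift = ℤ-Solver.solve-∀

valuesAt : ℕ → ℕ → ℤ → PQ × PQ → ℤ → ℚ
valuesAt b c k xy j = value (clusterVal b c k xy j)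

one-one : PQ × PQ
one-one = onePQ , onePQ

module _ (b c : ℕ) where

  clusterVal-ahead : ∀ k xy n → clusterVal b c k xy (k ℤ.+ + n) ≡ fwd b c n k xy
  clusterVal-ahead k xy n rewrite k+m-k≡m k (+ n) = refl

  clusterVal-behind : ∀ k xy n → clusterVal b c k xy (k ℤ.+ 1ℤ ℤ.- + suc n) ≡ bwd b c n k xy
  clusterVal-behind k xy n rewrite k+1-m-k≡1-m k (+ suc n) with n
  ... | zero  = refl
  ... | suc _ = refl

  fwd-exchange : ∀ k xy → Exchangeℕ (λ n → expo b c (k ℤ.+ + n)) (λ n → value (fwd b c n k xy))
  fwd-exchange k xy = mkExchangeℕ (relation k xy)
    where
    relation : ∀ k xy n → value (fwd b c n k xy) * value (fwd b c (suc (suc n)) k xy)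
                          ≡ (1ℚ + value (fwd b c (suc n) k xy)) ^ expo b c (k ℤ.+ + n)
    relation k (x , y) zero    rewrite ℤ.+-identityʳ k = exch-exchange (expo b c k) x y
    relation k (x , y) (suc n) rewrite sym (k+1+n≡k+[1+n] k n) =
      relation (k ℤ.+ 1ℤ) (y , exch (expo b c k) x y) n

  bwd-exchange : ∀ k xy → Exchangeℕ (λ n → expo b c (k ℤ.- + suc (suc n))) (λ n → value (bwd b c n k xy))
  bwd-exchange k xy = mkExchangeℕ (relation k xy)
    where
    relation : ∀ k xy n → value (bwd b c n k xy) * value (bwd b c (suc (suc n)) k xy)
                          ≡ (1ℚ + value (bwd b c (suc n) k xy)) ^ expo b c (k ℤ.- + suc (suc n))
    relation k (x , y) zero    rewrite sym (k-1-1≡k-2 k) =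
      exch-exchange (expo b c (k ℤ.- 1ℤ ℤ.- 1ℤ)) x (exch (expo b c (k ℤ.- 1ℤ)) y x)
    relation k (x , y) (suc n) rewrite sym (k-1-[2+n]≡k-[3+n] k n) =
      relation (k ℤ.- 1ℤ) (exch (expo b c (k ℤ.- 1ℤ)) y x , x) n

  valuesAt-exchange : ∀ k xy → Exchange (expo b c) (valuesAt b c k xy)
  valuesAt-exchange k (x , y) = exchange-glue k
    (Exchangeℕ-cong-values (λ n → cong value (sym (clusterVal-ahead k (x , y) n))) (fwd-exchange k (x , y)))
    (Exchangeℕ-cong-values below≡ (mkExchangeℕ below-exchange))
    where
    below : ℕ → ℚ
    below zero    = value y
    below (suc n) = value (bwd b c n k (x , y))
    below-exchange : ∀ n → below n * below (suc (suc n))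
                           ≡ (1ℚ + below (suc n)) ^ expo b c (k ℤ.+ 1ℤ ℤ.- + suc (suc n))
    below-exchange zero    rewrite k+1-2≡k-1 k = exch-exchange (expo b c (k ℤ.- 1ℤ)) y x
    below-exchange (suc n) rewrite k+1-[1+n]≡k-n k (suc (suc n)) = exchangeℕ (bwd-exchange k (x , y)) n
    below≡ : ∀ n → below n ≡ valuesAt b c k (x , y) (k ℤ.+ 1ℤ ℤ.- + n)
    below≡ zero    = cong value (sym (trans (cong (clusterVal b c k (x , y)) (ℤ.+-identityʳ (k ℤ.+ 1ℤ)))
                                            (clusterVal-ahead k (x , y) 1)))
    below≡ (suc n) = cong value (sym (clusterVal-behind k (x , y) n))

  valuesAt-pos : ∀ k xy j → 0ℚ ℚ.< valuesAt b c k xy j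
  valuesAt-pos k xy j = value-pos (clusterVal b c k xy j)

  valuesAt-first : ∀ k xy → valuesAt b c k xy k ≡ value (proj₁ xy)
  valuesAt-first k xy =
    cong value (trans (cong (clusterVal b c k xy) (sym (ℤ.+-identityʳ k))) (clusterVal-ahead k xy 0))

  valuesAt-second : ∀ k xy → valuesAt b c k xy (k ℤ.+ 1ℤ) ≡ value (proj₂ xy)
  valuesAt-second k xy = cong value (clusterVal-ahead k xy 1)

  valuesAt-rebase : ∀ k xy l j →
    valuesAt b c k xy j ≡ valuesAt b c l (clusterVal b c k xy l , clusterVal b c k xy (l ℤ.+ 1ℤ)) j
  valuesAt-rebase k xy l =
    exchange-unique (valuesAt-exchange k xy) (valuesAt-exchange l _) (valuesAt-pos k xy) l
                    (sym (valuesAt-first l _)) (sym (valuesAt-second l _))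

  fromℕ-friezeSeq-exchange : ∀ e₀ e₁ → Exchangeℕ (alternate e₀ e₁) (λ n → fromℕ (friezeSeq e₀ e₁ n))
  fromℕ-friezeSeq-exchange e₀ e₁ = mkExchangeℕ λ n → begin
    fromℕ (x n) * fromℕ (x (suc (suc n)))   ≡⟨ fromℕ-homo-* (x n) (x (suc (suc n))) ⟨
    fromℕ (x n ℕ.* x (suc (suc n)))         ≡⟨ cong fromℕ (friezeSeq-exchange e₀ e₁ n) ⟩
    fromℕ (suc (x (suc n)) ℕ.^ e n)         ≡⟨ fromℕ-homo-^ (suc (x (suc n))) (e n) ⟩
    fromℕ (1 ℕ.+ x (suc n)) ^ e n           ≡⟨ cong (_^ e n) (fromℕ-homo-+ 1 (x (suc n))) ⟩
    (fromℕ 1 + fromℕ (x (suc n))) ^ e n     ≡⟨ cong (λ t → (t + fromℕ (x (suc n))) ^ e n) fromℕ-1 ⟩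
    (1ℚ + fromℕ (x (suc n))) ^ e n          ∎
    where
    open ≡-Reasoning
    x = friezeSeq e₀ e₁
    e = alternate e₀ e₁

  valuesAt-one-ahead : ∀ k n →
    valuesAt b c k one-one (k ℤ.+ + n) ≡ fromℕ (friezeSeq (expo b c k) (expo b c (k ℤ.+ 1ℤ)) n)
  valuesAt-one-ahead k = exchangeℕ-unique
    (exchange-forward (valuesAt-exchange k one-one) k)
    (Exchangeℕ-cong-exponent (λ n → sym (expo-ahead b c k n)) (fromℕ-friezeSeq-exchange _ _))
    (λ n → valuesAt-pos k one-one (k ℤ.+ + n))
    (trans (cong (valuesAt b c k one-one) (ℤ.+-identityʳ k)) (trans (valuesAt-first k one-one) value-one))
    (trans (valuesAt-second k one-one) value-one)

  valuesAt-one-behind : ∀ k n →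
    valuesAt b c k one-one (k ℤ.+ 1ℤ ℤ.- + n) ≡ fromℕ (friezeSeq (expo b c (k ℤ.+ 1ℤ)) (expo b c k) n)
  valuesAt-one-behind k = exchangeℕ-unique
    (exchange-backward (valuesAt-exchange k one-one) (k ℤ.+ 1ℤ))
    (Exchangeℕ-cong-exponent (λ n → sym (expo-behind b c k n)) (fromℕ-friezeSeq-exchange _ _))
    (λ n → valuesAt-pos k one-one (k ℤ.+ 1ℤ ℤ.- + n))
    (trans (cong (valuesAt b c k one-one) (ℤ.+-identityʳ (k ℤ.+ 1ℤ)))
           (trans (valuesAt-second k one-one) value-one))
    (trans (cong (valuesAt b c k one-one) (k+1-1≡k k)) (trans (valuesAt-first k one-one) value-one))

  -- ψ k j = ψ_(x_k, x_{k+1})(x_j)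
  ψ : ℤ → ℤ → ℕ
  ψ k j with around k j
  ... | ahead n  = friezeSeq (expo b c k) (expo b c (k ℤ.+ 1ℤ)) n
  ... | behind n = friezeSeq (expo b c (k ℤ.+ 1ℤ)) (expo b c k) (suc (suc n))

  ψ-valuesAt : ∀ k j → fromℕ (ψ k j) ≡ valuesAt b c k one-one j
  ψ-valuesAt k j with around k j
  ... | ahead n  = sym (valuesAt-one-ahead k n)
  ... | behind n = sym (valuesAt-one-behind k (suc (suc n)))

  ψ-nonZero : ∀ k j → ℕ.NonZero (ψ k j)
  ψ-nonZero k j with around k j
  ... | ahead n  = friezeSeq-nonZero _ _ n
  ... | behind n = friezeSeq-nonZero _ _ (suc (suc n))

evalℤ : (ℤ → ℤ) → Term → ℤ
evalℤ v (var j) = v j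
evalℤ v (cst n) = n
evalℤ v (t ⊕ s) = evalℤ v t ℤ.+ evalℤ v s
evalℤ v (t ⊗ s) = evalℤ v t ℤ.* evalℤ v s
evalℤ v (⊖ t)   = ℤ.- evalℤ v t

evalℤ-/1 : ∀ v t → evalℤ v t ℚ./ 1 ≡ eval (λ j → v j ℚ./ 1) t
evalℤ-/1 v (var j) = refl
evalℤ-/1 v (cst n) = refl
evalℤ-/1 v (t ⊕ s) = trans (/1-homo-+ (evalℤ v t) (evalℤ v s)) (cong₂ _+_ (evalℤ-/1 v t) (evalℤ-/1 v s))
evalℤ-/1 v (t ⊗ s) = trans (/1-homo-* (evalℤ v t) (evalℤ v s)) (cong₂ _*_ (evalℤ-/1 v t) (evalℤ-/1 v s))
evalℤ-/1 v (⊖ t)   = trans (/1-homo‿- (evalℤ v t)) (cong ℚ.-_ (evalℤ-/1 v t))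

eval-cong : ∀ {v w} → (∀ j → v j ≡ w j) → ∀ t → eval v t ≡ eval w t
eval-cong v≗w (var j) = v≗w j
eval-cong v≗w (cst n) = refl
eval-cong v≗w (t ⊕ s) = cong₂ _+_ (eval-cong v≗w t) (eval-cong v≗w s)
eval-cong v≗w (t ⊗ s) = cong₂ _*_ (eval-cong v≗w t) (eval-cong v≗w s)
eval-cong v≗w (⊖ t)   = cong ℚ.-_ (eval-cong v≗w t)

module _ (b c : ℕ) where

  evalAt-valuesAt : ∀ k xy t → evalAt b c k xy t ≡ eval (valuesAt b c k xy) t
  evalAt-valuesAt k xy = eval-cong (λ j → sym (value≡toℚ (clusterVal b c k xy j)))

  ψ-eval : ∀ k t → evalℤ (λ j → + ψ b c k j) t ℚ./ 1 ≡ eval (valuesAt b c k one-one) t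
  ψ-eval k t = begin
    evalℤ (λ j → + ψ b c k j) t ℚ./ 1   ≡⟨ evalℤ-/1 _ t ⟩
    eval (λ j → + ψ b c k j ℚ./ 1) t   ≡⟨ eval-cong (λ j → sym (fromℕ-/1 (ψ b c k j))) t ⟩
    eval (λ j → fromℕ (ψ b c k j)) t   ≡⟨ eval-cong (ψ-valuesAt b c k) t ⟩
    eval (valuesAt b c k one-one) t    ∎
    where open ≡-Reasoning

  ψ-frieze : ℤ → Frieze b c
  ψ-frieze k = record
    { f     = evalℤ (λ j → + ψ b c k j)
    ; resp  = λ {t} {s} → respects t s
    ; f-cst = λ _ → refl
    ; f-⊕   = λ _ _ → refl
    ; f-⊗   = λ _ _ → refl
    ; f-⊖   = λ _ → refl
    ; pos   = λ j → ℤ.+<+ (ℕ.>-nonZero⁻¹ _ {{ψ-nonZero b c k j}})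
    }
    where
    xy₁ = clusterVal b c k one-one (+ 1) , clusterVal b c k one-one (+ 2)
    ψ-evalAt₁ : ∀ t → evalℤ (λ j → + ψ b c k j) t ℚ./ 1 ≡ evalAt b c (+ 1) xy₁ t
    ψ-evalAt₁ t = trans (ψ-eval k t) (trans (eval-cong (valuesAt-rebase b c k one-one (+ 1)) t)
                                            (sym (evalAt-valuesAt (+ 1) xy₁ t)))
    respects : ∀ t s → t ≈[ b , c ] s → evalℤ (λ j → + ψ b c k j) t ≡ evalℤ (λ j → + ψ b c k j) s
    respects t s t≈s = /1-injective (trans (ψ-evalAt₁ t) (trans (t≈s xy₁) (sym (ψ-evalAt₁ s))))

  ψ-frieze-isPsi : ∀ k → IsPsi b c k (ψ-frieze k)
  ψ-frieze-isPsi k t = trans (ψ-eval k t) (sym (evalAt-valuesAt k one-one t))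

module _ where
  open import Agda.Builtin.FromNat using (fromNat)
  open import Data.Unit using (tt)
  import Data.Nat.Literals as ℕ
  import Data.Rational.Literals as ℚ

  instance
    _ = ℕ.number
    _ = ℚ.number

  monomial-pos : ∀ {x y} → 0ℚ ℚ.< x → 0ℚ ℚ.< y → ∀ i j → 0ℚ ℚ.< x ^ i * y ^ j
  monomial-pos x>0 y>0 i j = *-pos (^-pos i x>0) (^-pos j y>0)

  over-1 : ∀ v → Fraction v v 1
  over-1 v = record { denominator>0 = ℚ.positive⁻¹ 1ℚ ; value*denominator = ℚ.*-identityʳ v }

  over-1⁻¹ : ∀ {v n} → Fraction v n 1 → v ≡ n
  over-1⁻¹ {v} v≡n/1 = trans (sym (ℚ.*-identityʳ v)) (value*denominator v≡n/1)

  -- In terms of x = x₀ and y = x₁, each x_j is a polynomial over a monomial x^i y^j; every step below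
  -- checks one exchange relation as a polynomial identity.
  A₂-window : ∀ {v} → Exchange (expo 1 1) v → (∀ j → 0ℚ ℚ.< v j) →
    v (+ 5) ≡ v (+ 0) × v (+ 6) ≡ v (+ 1)
  A₂-window {v} ex v>0 = over-1⁻¹ x₅ , over-1⁻¹ x₆
    where
    x = v (+ 0)
    y = v (+ 1)
    d : ∀ i j → 0ℚ ℚ.< x ^ i * y ^ j
    d = monomial-pos (v>0 (+ 0)) (v>0 (+ 1))
    x₀ : Fraction x x 1
    x₀ = over-1 x
    x₁ : Fraction y y 1
    x₁ = over-1 y
    x₂ : Fraction (v (+ 2)) (1 + y) (x ^ 1 * y ^ 0)
    x₂ = exchange⇒fraction 1 (v>0 (+ 0)) (d 1 0) x₀ x₁ (identity x y) (exchange ex (+ 0))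
      where
      identity : ∀ x y → 1 * (x ^ 1 * y ^ 0) * (1 + y)
                       ≡ x * (1 + y) * 1
      identity = solve-∀ ℚ-ring
    x₃ : Fraction (v (+ 3)) (1 + x + y) (x ^ 1 * y ^ 1)
    x₃ = exchange⇒fraction 1 (v>0 (+ 1)) (d 1 1) x₁ x₂ (identity x y) (exchange ex (+ 1))
      where
      identity : ∀ x y → 1 * (x ^ 1 * y ^ 1) * (x ^ 1 * y ^ 0 + (1 + y))
                       ≡ y * (1 + x + y) * (x ^ 1 * y ^ 0)
      identity = solve-∀ ℚ-ring
    x₄ : Fraction (v (+ 4)) (1 + x) (x ^ 0 * y ^ 1)
    x₄ = exchange⇒fraction 1 (v>0 (+ 2)) (d 0 1) x₂ x₃ (identity x y) (exchange ex (+ 2))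
      where
      identity : ∀ x y → (x ^ 1 * y ^ 0) * (x ^ 0 * y ^ 1) * (x ^ 1 * y ^ 1 + (1 + x + y))
                       ≡ (1 + y) * (1 + x) * (x ^ 1 * y ^ 1)
      identity = solve-∀ ℚ-ring
    x₅ : Fraction (v (+ 5)) x 1
    x₅ = exchange⇒fraction 1 (v>0 (+ 3)) (d 0 0) x₃ x₄ (identity x y) (exchange ex (+ 3))
      where
      identity : ∀ x y → (x ^ 1 * y ^ 1) * 1 * (x ^ 0 * y ^ 1 + (1 + x))
                       ≡ (1 + x + y) * x * (x ^ 0 * y ^ 1)
      identity = solve-∀ ℚ-ring
    x₆ : Fraction (v (+ 6)) y 1
    x₆ = exchange⇒fraction 1 (v>0 (+ 4)) (d 0 0) x₄ x₅ (identity x y) (exchange ex (+ 4))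
      where
      identity : ∀ x y → (x ^ 0 * y ^ 1) * 1 * (1 + x)
                       ≡ (1 + x) * y * 1
      identity = solve-∀ ℚ-ring

  B₂-window : ∀ {v} → Exchange (expo 1 2) v → (∀ j → 0ℚ ℚ.< v j) →
    v (+ 6) ≡ v (+ 0) × v (+ 7) ≡ v (+ 1)
  B₂-window {v} ex v>0 = over-1⁻¹ x₆ , over-1⁻¹ x₇
    where
    x = v (+ 0)
    y = v (+ 1)
    d : ∀ i j → 0ℚ ℚ.< x ^ i * y ^ j
    d = monomial-pos (v>0 (+ 0)) (v>0 (+ 1))
    x₀ : Fraction x x 1
    x₀ = over-1 x
    x₁ : Fraction y y 1
    x₁ = over-1 y
    x₂ : Fraction (v (+ 2)) (1 + y) (x ^ 1 * y ^ 0)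
    x₂ = exchange⇒fraction 1 (v>0 (+ 0)) (d 1 0) x₀ x₁ (identity x y) (exchange ex (+ 0))
      where
      identity : ∀ x y → 1 * (x ^ 1 * y ^ 0) * (1 + y)
                       ≡ x * (1 + y) * 1
      identity = solve-∀ ℚ-ring
    x₃ : Fraction (v (+ 3)) ((1 + x + y) ^ 2) (x ^ 2 * y ^ 1)
    x₃ = exchange⇒fraction 2 (v>0 (+ 1)) (d 2 1) x₁ x₂ (identity x y) (exchange ex (+ 1))
      where
      identity : ∀ x y → 1 * (x ^ 2 * y ^ 1) * (x ^ 1 * y ^ 0 + (1 + y)) ^ 2
                       ≡ y * (1 + x + y) ^ 2 * (x ^ 1 * y ^ 0) ^ 2
      identity = solve-∀ ℚ-ring
    x₄ : Fraction (v (+ 4)) ((1 + x) ^ 2 + y) (x ^ 1 * y ^ 1)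
    x₄ = exchange⇒fraction 1 (v>0 (+ 2)) (d 1 1) x₂ x₃ (identity x y) (exchange ex (+ 2))
      where
      identity : ∀ x y → (x ^ 1 * y ^ 0) * (x ^ 1 * y ^ 1) * (x ^ 2 * y ^ 1 + (1 + x + y) ^ 2)
                       ≡ (1 + y) * ((1 + x) ^ 2 + y) * (x ^ 2 * y ^ 1)
      identity = solve-∀ ℚ-ring
    x₅ : Fraction (v (+ 5)) ((1 + x) ^ 2) (x ^ 0 * y ^ 1)
    x₅ = exchange⇒fraction 2 (v>0 (+ 3)) (d 0 1) x₃ x₄ (identity x y) (exchange ex (+ 3))
      where
      identity : ∀ x y → (x ^ 2 * y ^ 1) * (x ^ 0 * y ^ 1) * (x ^ 1 * y ^ 1 + ((1 + x) ^ 2 + y)) ^ 2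
                       ≡ (1 + x + y) ^ 2 * (1 + x) ^ 2 * (x ^ 1 * y ^ 1) ^ 2
      identity = solve-∀ ℚ-ring
    x₆ : Fraction (v (+ 6)) x 1
    x₆ = exchange⇒fraction 1 (v>0 (+ 4)) (d 0 0) x₄ x₅ (identity x y) (exchange ex (+ 4))
      where
      identity : ∀ x y → (x ^ 1 * y ^ 1) * 1 * (x ^ 0 * y ^ 1 + (1 + x) ^ 2)
                       ≡ ((1 + x) ^ 2 + y) * x * (x ^ 0 * y ^ 1)
      identity = solve-∀ ℚ-ring
    x₇ : Fraction (v (+ 7)) y 1
    x₇ = exchange⇒fraction 2 (v>0 (+ 5)) (d 0 0) x₅ x₆ (identity x y) (exchange ex (+ 5))
      where
      identity : ∀ x y → (x ^ 0 * y ^ 1) * 1 * (1 + x) ^ 2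
                       ≡ (1 + x) ^ 2 * y * 1 ^ 2
      identity = solve-∀ ℚ-ring

  G₂-window : ∀ {v} → Exchange (expo 1 3) v → (∀ j → 0ℚ ℚ.< v j) →
    v (+ 8) ≡ v (+ 0) × v (+ 9) ≡ v (+ 1)
  G₂-window {v} ex v>0 = over-1⁻¹ x₈ , over-1⁻¹ x₉
    where
    x = v (+ 0)
    y = v (+ 1)
    d : ∀ i j → 0ℚ ℚ.< x ^ i * y ^ j
    d = monomial-pos (v>0 (+ 0)) (v>0 (+ 1))
    x₀ : Fraction x x 1
    x₀ = over-1 x
    x₁ : Fraction y y 1
    x₁ = over-1 y
    x₂ : Fraction (v (+ 2)) (1 + y) (x ^ 1 * y ^ 0)
    x₂ = exchange⇒fraction 1 (v>0 (+ 0)) (d 1 0) x₀ x₁ (identity x y) (exchange ex (+ 0))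
      where
      identity : ∀ x y → 1 * (x ^ 1 * y ^ 0) * (1 + y)
                       ≡ x * (1 + y) * 1
      identity = solve-∀ ℚ-ring
    x₃ : Fraction (v (+ 3)) ((1 + x + y) ^ 3) (x ^ 3 * y ^ 1)
    x₃ = exchange⇒fraction 3 (v>0 (+ 1)) (d 3 1) x₁ x₂ (identity x y) (exchange ex (+ 1))
      where
      identity : ∀ x y → 1 * (x ^ 3 * y ^ 1) * (x ^ 1 * y ^ 0 + (1 + y)) ^ 3
                       ≡ y * (1 + x + y) ^ 3 * (x ^ 1 * y ^ 0) ^ 3
      identity = solve-∀ ℚ-ring
    x₄ : Fraction (v (+ 4)) ((1 + x) ^ 3 + (2 + 3 * x) * y + y ^ 2) (x ^ 2 * y ^ 1)
    x₄ = exchange⇒fraction 1 (v>0 (+ 2)) (d 2 1) x₂ x₃ (identity x y) (exchange ex (+ 2))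
      where
      identity : ∀ x y → (x ^ 1 * y ^ 0) * (x ^ 2 * y ^ 1) * (x ^ 3 * y ^ 1 + (1 + x + y) ^ 3)
                       ≡ (1 + y) * ((1 + x) ^ 3 + (2 + 3 * x) * y + y ^ 2) * (x ^ 3 * y ^ 1)
      identity = solve-∀ ℚ-ring
    x₅ : Fraction (v (+ 5)) (((1 + x) ^ 2 + y) ^ 3) (x ^ 3 * y ^ 2)
    x₅ = exchange⇒fraction 3 (v>0 (+ 3)) (d 3 2) x₃ x₄ (identity x y) (exchange ex (+ 3))
      where
      identity : ∀ x y → (x ^ 3 * y ^ 1) * (x ^ 3 * y ^ 2)
                           * (x ^ 2 * y ^ 1 + ((1 + x) ^ 3 + (2 + 3 * x) * y + y ^ 2)) ^ 3
                       ≡ (1 + x + y) ^ 3 * ((1 + x) ^ 2 + y) ^ 3 * (x ^ 2 * y ^ 1) ^ 3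
      identity = solve-∀ ℚ-ring
    x₆ : Fraction (v (+ 6)) ((1 + x) ^ 3 + y) (x ^ 1 * y ^ 1)
    x₆ = exchange⇒fraction 1 (v>0 (+ 4)) (d 1 1) x₄ x₅ (identity x y) (exchange ex (+ 4))
      where
      identity : ∀ x y → (x ^ 2 * y ^ 1) * (x ^ 1 * y ^ 1) * (x ^ 3 * y ^ 2 + ((1 + x) ^ 2 + y) ^ 3)
                       ≡ ((1 + x) ^ 3 + (2 + 3 * x) * y + y ^ 2) * ((1 + x) ^ 3 + y) * (x ^ 3 * y ^ 2)
      identity = solve-∀ ℚ-ring
    x₇ : Fraction (v (+ 7)) ((1 + x) ^ 3) (x ^ 0 * y ^ 1)
    x₇ = exchange⇒fraction 3 (v>0 (+ 5)) (d 0 1) x₅ x₆ (identity x y) (exchange ex (+ 5))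
      where
      identity : ∀ x y → (x ^ 3 * y ^ 2) * (x ^ 0 * y ^ 1) * (x ^ 1 * y ^ 1 + ((1 + x) ^ 3 + y)) ^ 3
                       ≡ ((1 + x) ^ 2 + y) ^ 3 * (1 + x) ^ 3 * (x ^ 1 * y ^ 1) ^ 3
      identity = solve-∀ ℚ-ring
    x₈ : Fraction (v (+ 8)) x 1
    x₈ = exchange⇒fraction 1 (v>0 (+ 6)) (d 0 0) x₆ x₇ (identity x y) (exchange ex (+ 6))
      where
      identity : ∀ x y → (x ^ 1 * y ^ 1) * 1 * (x ^ 0 * y ^ 1 + (1 + x) ^ 3)
                       ≡ ((1 + x) ^ 3 + y) * x * (x ^ 0 * y ^ 1)
      identity = solve-∀ ℚ-ring
    x₉ : Fraction (v (+ 9)) y 1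
    x₉ = exchange⇒fraction 3 (v>0 (+ 7)) (d 0 0) x₇ x₈ (identity x y) (exchange ex (+ 7))
      where
      identity : ∀ x y → (x ^ 0 * y ^ 1) * 1 * (1 + x) ^ 3
                       ≡ (1 + x) ^ 3 * y * 1 ^ 3
      identity = solve-∀ ℚ-ring

data FiniteType : ℕ → ℕ → Set where
  A₂  : FiniteType 1 1
  B₂  : FiniteType 1 2
  B₂′ : FiniteType 2 1
  G₂  : FiniteType 1 3
  G₂′ : FiniteType 3 1

period : ∀ {b c} → FiniteType b c → ℕ
period A₂  = 5
period B₂  = 6
period B₂′ = 6
period G₂  = 8
period G₂′ = 8

period-nonZero : ∀ {b c} (ft : FiniteType b c) → ℕ.NonZero (period ft)
period-nonZero A₂  = _
period-nonZero B₂  = _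
period-nonZero B₂′ = _
period-nonZero G₂  = _
period-nonZero G₂′ = _

swap : ∀ {b c} → FiniteType b c → FiniteType c b
swap A₂  = A₂
swap B₂  = B₂′
swap B₂′ = B₂
swap G₂  = G₂′
swap G₂′ = G₂

period-swap : ∀ {b c} (ft : FiniteType b c) → period (swap ft) ≡ period ft
period-swap A₂  = refl
period-swap B₂  = refl
period-swap B₂′ = refl
period-swap G₂  = refl
period-swap G₂′ = refl

finite-or-growing : ∀ b c → 1 ≤ b → 1 ≤ c → FiniteType b c ⊎ Growing b c
finite-or-growing 1 1 _ _ = inj₁ A₂
finite-or-growing 1 2 _ _ = inj₁ B₂
finite-or-growing 1 3 _ _ = inj₁ G₂
finite-or-growing 2 1 _ _ = inj₁ B₂′
finite-or-growing 3 1 _ _ = inj₁ G₂′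
finite-or-growing 1 c@(suc (suc (suc (suc _)))) 1≤b 1≤c =
  inj₂ (1≤b , 1≤c , subst (4 ℕ.≤_) (sym (ℕ.*-identityˡ c)) (ℕ.s≤s (ℕ.s≤s (ℕ.s≤s (ℕ.s≤s ℕ.z≤n)))))
finite-or-growing b@(suc (suc (suc (suc _)))) 1 1≤b 1≤c =
  inj₂ (1≤b , 1≤c , subst (4 ℕ.≤_) (sym (ℕ.*-identityʳ b)) (ℕ.s≤s (ℕ.s≤s (ℕ.s≤s (ℕ.s≤s ℕ.z≤n)))))
finite-or-growing b@(suc (suc _)) c@(suc (suc _)) 1≤b 1≤c =
  inj₂ (1≤b , 1≤c , ℕ.*-mono-≤ {2} {b} {2} {c} (ℕ.s≤s (ℕ.s≤s ℕ.z≤n)) (ℕ.s≤s (ℕ.s≤s ℕ.z≤n)))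

finite-periodic : ∀ {b c v} (ft : FiniteType b c) → Exchange (expo b c) v → (∀ j → 0ℚ ℚ.< v j) →
  ∀ j → v (j ℤ.+ + period ft) ≡ v j
finite-periodic A₂ ex v>0 = exchange-periodic 5 ex v>0
  (λ j → trans (expo-diagonal 1 (j ℤ.+ + 5)) (sym (expo-diagonal 1 j))) (+ 0) (proj₁ window) (proj₂ window)
  where window = A₂-window ex v>0
finite-periodic B₂ ex v>0 = exchange-periodic 6 ex v>0
  (λ j → periodic-multiple 2 (expo-periodic 1 2) j (+ 3)) (+ 0) (proj₁ window) (proj₂ window)
  where window = B₂-window ex v>0
finite-periodic B₂′ ex v>0 = exchange-periodic 6 ex v>0
  (λ j → periodic-multiple 2 (expo-periodic 2 1) j (+ 3)) (+ 1) (proj₁ window) (proj₂ window)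
  where
  window = B₂-window (Exchange-cong-exponent (expo-suc 2 1) (exchange-shift ex 1ℤ)) (λ j → v>0 (j ℤ.+ 1ℤ))
finite-periodic G₂ ex v>0 = exchange-periodic 8 ex v>0
  (λ j → periodic-multiple 2 (expo-periodic 1 3) j (+ 4)) (+ 0) (proj₁ window) (proj₂ window)
  where window = G₂-window ex v>0
finite-periodic G₂′ ex v>0 = exchange-periodic 8 ex v>0
  (λ j → periodic-multiple 2 (expo-periodic 3 1) j (+ 4)) (+ 1) (proj₁ window) (proj₂ window)
  where
  window = G₂-window (Exchange-cong-exponent (expo-suc 3 1) (exchange-shift ex 1ℤ)) (λ j → v>0 (j ℤ.+ 1ℤ))

OnesOnlyAtZero : ℕ → ℕ → ℕ → Set
OnesOnlyAtZero e₀ e₁ r = friezeSeq e₀ e₁ r ≡ 1 → friezeSeq e₀ e₁ (suc r) ≡ 1 → r ≡ 0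

onesOnlyAtZero? : ∀ e₀ e₁ r → Dec (OnesOnlyAtZero e₀ e₁ r)
onesOnlyAtZero? e₀ e₁ r = (friezeSeq e₀ e₁ r ℕ.≟ 1) →-dec ((friezeSeq e₀ e₁ (suc r) ℕ.≟ 1) →-dec (r ℕ.≟ 0))

finite-onesOnlyAtZero : ∀ {b c} (ft : FiniteType b c) r → r ℕ.< period ft → OnesOnlyAtZero b c r
finite-onesOnlyAtZero ft r r<p = subst (OnesOnlyAtZero _ _) (Fin.toℕ-fromℕ< r<p) (decided ft (Fin.fromℕ< r<p))
  where
  decided : ∀ {b c} (ft : FiniteType b c) (i : Fin.Fin (period ft)) → OnesOnlyAtZero b c (Fin.toℕ i)
  decided A₂  = from-yes (Fin.all? {n = 5} (λ i → onesOnlyAtZero? 1 1 (Fin.toℕ i)))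
  decided B₂  = from-yes (Fin.all? {n = 6} (λ i → onesOnlyAtZero? 1 2 (Fin.toℕ i)))
  decided B₂′ = from-yes (Fin.all? {n = 6} (λ i → onesOnlyAtZero? 2 1 (Fin.toℕ i)))
  decided G₂  = from-yes (Fin.all? {n = 8} (λ i → onesOnlyAtZero? 1 3 (Fin.toℕ i)))
  decided G₂′ = from-yes (Fin.all? {n = 8} (λ i → onesOnlyAtZero? 3 1 (Fin.toℕ i)))

finite-onesOnlyAtZero-expo : ∀ {b c} (ft : FiniteType b c) k r → r ℕ.< period ft →
  OnesOnlyAtZero (expo b c k) (expo b c (k ℤ.+ 1ℤ)) r
finite-onesOnlyAtZero-expo {b} {c} ft k r r<p with expo-cases b c k
... | inj₁ (e₀≡b , e₁≡c) rewrite e₀≡b | e₁≡c = finite-onesOnlyAtZero ft r r<p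
... | inj₂ (e₀≡c , e₁≡b) rewrite e₀≡c | e₁≡b =
  finite-onesOnlyAtZero (swap ft) r (subst (r ℕ.<_) (sym (period-swap ft)) r<p)

Growing-expo : ∀ {b c} → Growing b c → ∀ k → Growing (expo b c k) (expo b c (k ℤ.+ 1ℤ))
Growing-expo {b} {c} g k with expo-cases b c k
... | inj₁ (e₀≡b , e₁≡c) rewrite e₀≡b | e₁≡c = g
... | inj₂ (e₀≡c , e₁≡b) rewrite e₀≡c | e₁≡b = Growing-swap g

fromℕ-friezeSeq-≢1 : ∀ {e₀ e₁} → Growing e₀ e₁ → ∀ n → fromℕ (friezeSeq e₀ e₁ (suc (suc n))) ≢ 1ℚ
fromℕ-friezeSeq-≢1 g n eq =
  ℕ.<⇒≱ (friezeSeq-≥2 g n) (ℕ.≤-reflexive (fromℕ-injective (trans eq (sym fromℕ-1))))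

module _ {b c : ℕ} where

  same-cluster-≡ : ∀ {k l} → k ≡ l → SameCluster b c k l
  same-cluster-≡ refl = inj₁ ((λ _ → refl) , (λ _ → refl))

  ≈-var : ∀ {i j} → (∀ xy → valuesAt b c (+ 1) xy i ≡ valuesAt b c (+ 1) xy j) → var i ≈[ b , c ] var j
  ≈-var {i} {j} eq xy = trans (sym (value≡toℚ (clusterVal b c (+ 1) xy i)))
                              (trans (eq xy) (value≡toℚ (clusterVal b c (+ 1) xy j)))

  periodic-same-cluster : (ft : FiniteType b c) → ∀ k q → SameCluster b c k (k ℤ.+ q ℤ.* + period ft)
  periodic-same-cluster ft k q = inj₁
    ( ≈-var {k} {k ℤ.+ q ℤ.* + period ft} (λ xy → sym (periodic xy k))
    , ≈-var {k ℤ.+ 1ℤ} {k ℤ.+ q ℤ.* + period ft ℤ.+ 1ℤ}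
            (λ xy → trans (sym (periodic xy (k ℤ.+ 1ℤ)))
                          (cong (valuesAt b c (+ 1) xy) (swap-+1 k (q ℤ.* + period ft))))
    )
    where
    periodic : ∀ xy j → valuesAt b c (+ 1) xy (j ℤ.+ q ℤ.* + period ft) ≡ valuesAt b c (+ 1) xy j
    periodic xy j = periodic-multiple (period ft)
      (finite-periodic ft (valuesAt-exchange b c (+ 1) xy) (valuesAt-pos b c (+ 1) xy)) j q
    swap-+1 : ∀ k s → k ℤ.+ 1ℤ ℤ.+ s ≡ k ℤ.+ s ℤ.+ 1ℤ
    swap-+1 = ℤ-Solver.solve-∀

  ones⇒≡ : Growing b c → ∀ k l → valuesAt b c k one-one l ≡ 1ℚ →
    valuesAt b c k one-one (l ℤ.+ 1ℤ) ≡ 1ℚ → k ≡ l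
  ones⇒≡ g k l xₗ≡1 xₗ₊₁≡1 with around k l
  ... | ahead zero          = sym (ℤ.+-identityʳ k)
  ... | ahead (suc zero)    = ⊥-elim (fromℕ-friezeSeq-≢1 (Growing-expo g k) 0
                                (trans (sym (valuesAt-one-ahead b c k 2)) xₖ₊₂≡1))
    where xₖ₊₂≡1 = subst (λ i → valuesAt b c k one-one i ≡ 1ℚ) (k+n+1≡k+[1+n] k 1) xₗ₊₁≡1
  ... | ahead (suc (suc n)) = ⊥-elim (fromℕ-friezeSeq-≢1 (Growing-expo g k) n
                                (trans (sym (valuesAt-one-ahead b c k (suc (suc n)))) xₗ≡1))
  ... | behind n            = ⊥-elim (fromℕ-friezeSeq-≢1 (Growing-swap (Growing-expo g k)) n
                                (trans (sym (valuesAt-one-behind b c k (suc (suc n)))) xₗ≡1))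

  ones⇒period-multiple : (ft : FiniteType b c) → ∀ k l → valuesAt b c k one-one l ≡ 1ℚ →
    valuesAt b c k one-one (l ℤ.+ 1ℤ) ≡ 1ℚ → ∃[ q ] l ≡ k ℤ.+ q ℤ.* + period ft
  ones⇒period-multiple ft k l xₗ≡1 xₗ₊₁≡1 = q , trans l≡ (cong (λ i → i ℤ.+ q ℤ.* + p) k+r≡k)
    where
    instance _ = period-nonZero ft
    p = period ft
    r = (l ℤ.- k) ℤ.%ℕ p
    q = (l ℤ.- k) ℤ./ℕ p
    l≡ : l ≡ k ℤ.+ + r ℤ.+ q ℤ.* + p
    l≡ = trans (sym (k+[l-k]≡l k l)) (trans (cong (λ d → k ℤ.+ d) (ℤ.a≡a%ℕn+[a/ℕn]*n (l ℤ.- k) p))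
                                            (sym (ℤ.+-assoc k (+ r) (q ℤ.* + p))))
      where
      k+[l-k]≡l : ∀ k l → k ℤ.+ (l ℤ.- k) ≡ l
      k+[l-k]≡l = ℤ-Solver.solve-∀
    l+1≡ : l ℤ.+ 1ℤ ≡ k ℤ.+ + suc r ℤ.+ q ℤ.* + p
    l+1≡ = trans (cong (ℤ._+ 1ℤ) l≡) (shift k (+ r) (q ℤ.* + p))
      where
      shift : ∀ k r s → k ℤ.+ r ℤ.+ s ℤ.+ 1ℤ ≡ k ℤ.+ (1ℤ ℤ.+ r) ℤ.+ s
      shift = ℤ-Solver.solve-∀
    one-at : ∀ s {i} → i ≡ k ℤ.+ + s ℤ.+ q ℤ.* + p → valuesAt b c k one-one i ≡ 1ℚ →
      friezeSeq (expo b c k) (expo b c (k ℤ.+ 1ℤ)) s ≡ 1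
    one-at s {i} i≡ xᵢ≡1 = fromℕ-injective (begin
      fromℕ (friezeSeq (expo b c k) (expo b c (k ℤ.+ 1ℤ)) s)  ≡⟨ valuesAt-one-ahead b c k s ⟨
      valuesAt b c k one-one (k ℤ.+ + s)                      ≡⟨ periodic (k ℤ.+ + s) ⟨
      valuesAt b c k one-one (k ℤ.+ + s ℤ.+ q ℤ.* + p)        ≡⟨ cong (valuesAt b c k one-one) i≡ ⟨
      valuesAt b c k one-one i                                ≡⟨ trans xᵢ≡1 (sym fromℕ-1) ⟩
      fromℕ 1                                                 ∎)
      where
      open ≡-Reasoning
      periodic : ∀ j → valuesAt b c k one-one (j ℤ.+ q ℤ.* + p) ≡ valuesAt b c k one-one j
      periodic j = periodic-multiple p
        (finite-periodic ft (valuesAt-exchange b c k one-one) (valuesAt-pos b c k one-one)) j q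
    k+r≡k : k ℤ.+ + r ≡ k
    k+r≡k = trans (cong (λ r → k ℤ.+ + r) (finite-onesOnlyAtZero-expo ft k r (ℤ.n%ℕd<d (l ℤ.- k) p)
                                             (one-at r l≡ xₗ≡1) (one-at (suc r) l+1≡ xₗ₊₁≡1)))
                  (ℤ.+-identityʳ k)

  ones⇒same-cluster : 1 ≤ b → 1 ≤ c → ∀ k l → valuesAt b c k one-one l ≡ 1ℚ →
    valuesAt b c k one-one (l ℤ.+ 1ℤ) ≡ 1ℚ → SameCluster b c k l
  ones⇒same-cluster 1≤b 1≤c k l xₗ≡1 xₗ₊₁≡1 = [ finite , growing ]′ (finite-or-growing b c 1≤b 1≤c)
    where
    finite : FiniteType b c → SameCluster b c k l
    finite ft = subst (SameCluster b c k) (sym (proj₂ l≡)) (periodic-same-cluster ft k (proj₁ l≡))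
      where l≡ = ones⇒period-multiple ft k l xₗ≡1 xₗ₊₁≡1
    growing : Growing b c → SameCluster b c k l
    growing g = same-cluster-≡ (ones⇒≡ g k l xₗ≡1 xₗ₊₁≡1)

  isPsi-var : ∀ {k} (F : Frieze b c) → IsPsi b c k F → ∀ j → f F (var j) ℚ./ 1 ≡ valuesAt b c k one-one j
  isPsi-var {k} F F≡ψₖ j = trans (F≡ψₖ (var j)) (sym (value≡toℚ (clusterVal b c k one-one j)))

  -- ψ_k and ψ_l already differ on x_l or on x_{l+1}.
  distinct-friezes : 1 ≤ b → 1 ≤ c → ∀ k l → ¬ SameCluster b c k l → (F G : Frieze b c) →
    IsPsi b c k F → IsPsi b c l G → ∃ (λ t → f F t ≢ f G t)
  distinct-friezes 1≤b 1≤c k l k≁l F G F≡ψₖ G≡ψₗ =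
    compare (f F (var l) ℤ.≟ f G (var l)) (f F (var (l ℤ.+ 1ℤ)) ℤ.≟ f G (var (l ℤ.+ 1ℤ)))
    where
    one-at : ∀ {j} → valuesAt b c l one-one j ≡ value onePQ → f F (var j) ≡ f G (var j) →
      valuesAt b c k one-one j ≡ 1ℚ
    one-at {j} ψₗxⱼ≡1 Fxⱼ≡Gxⱼ = begin
      valuesAt b c k one-one j   ≡⟨ isPsi-var F F≡ψₖ j ⟨
      f F (var j) ℚ./ 1          ≡⟨ cong (ℚ._/ 1) Fxⱼ≡Gxⱼ ⟩
      f G (var j) ℚ./ 1          ≡⟨ isPsi-var G G≡ψₗ j ⟩
      valuesAt b c l one-one j   ≡⟨ ψₗxⱼ≡1 ⟩
      value onePQ                ≡⟨ value-one ⟩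
      fromℕ 1                    ≡⟨ fromℕ-1 ⟩
      1ℚ                         ∎
      where open ≡-Reasoning
    compare : Dec (f F (var l) ≡ f G (var l)) → Dec (f F (var (l ℤ.+ 1ℤ)) ≡ f G (var (l ℤ.+ 1ℤ))) →
      ∃ (λ t → f F t ≢ f G t)
    compare (no Fxₗ≢Gxₗ)  _                = var l , Fxₗ≢Gxₗ
    compare (yes _)       (no Fxₗ₊₁≢Gxₗ₊₁) = var (l ℤ.+ 1ℤ) , Fxₗ₊₁≢Gxₗ₊₁
    compare (yes Fxₗ≡Gxₗ) (yes Fxₗ₊₁≡Gxₗ₊₁) = ⊥-elim (k≁l (ones⇒same-cluster 1≤b 1≤c k l
      (one-at (valuesAt-first b c l one-one) Fxₗ≡Gxₗ) (one-at (valuesAt-second b c l one-one) Fxₗ₊₁≡Gxₗ₊₁)))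

lemma4p4 : (b c : ℕ) → 1 ≤ b → 1 ≤ c →
    ((k : ℤ) → Σ (Frieze b c) (λ F → IsPsi b c k F))
    × ((k l : ℤ) → ¬ SameCluster b c k l →
       (F G : Frieze b c) → IsPsi b c k F → IsPsi b c l G →
       ∃ (λ t → f F t ≢ f G t))
lemma4p4 b c 1≤b 1≤c = (λ k → ψ-frieze b c k , ψ-frieze-isPsi b c k) , distinct-friezes 1≤b 1≤c
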